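{- For $N\ge 0$ let $a_N$ be the number of tilings of the $3\times 3\times \tfrac{N}{3}$ box by $1\times1\times 3$ bricks when $N/3$ is a positive integer, $a_N=0$ when $N/3$ is not an integer, and $a_0=1$. Then $$\sum_{N\ge 0} a_N z^N=\frac{1-z^3-2z^6-4z^9+z^{12}-z^{15}+z^{18}-z^{21}}{(1-z^3)(1-2z^3-2z^6-15z^9-17z^{12}-6z^{15}+z^{18}-3z^{21}-z^{27})}=1+2z^3+4z^6+21z^9+92z^{12}+320z^{15}+\cdots.$$
   Context: A tiling of a $k\times m\times n$ box (made of $kmn$ unit cubes) by $t_1\times t_2\times t_3$ bricks is a set of non-overlapping axis-parallel boxes with integer corners, each congruent to the brick (i.e. of dimensions some permutation of $(t_1,t_2,t_3)$; all orientations may be mixed), whose union is the box. Tilings related by a symmetry of the box are counted separately. $N$ is the number of bricks used. -}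

module Defs where

open import Data.Nat using (ℕ; zero; suc; _+_; _≤ᵇ_; _<ᵇ_; _≡ᵇ_)
open import Data.Bool using (Bool; true; false; _∧_; if_then_else_; T)
open import Data.Fin using (Fin; toℕ) renaming (zero to f0; suc to fs)
open import Data.Fin.Properties using () renaming (_≟_ to _≟F_)
open import Data.Vec using (Vec; lookup)
open import Data.List using (List; []; _∷_; map; allFin)
open import Data.Bool.ListAction using (and)
open import Data.Nat.ListAction using (sum)
import Data.List as L
open import Data.Integer using (ℤ; +_; -[1+_]) renaming (_+_ to _+ℤ_; _*_ to _*ℤ_)
open import Data.Product using (Σ; _×_; _,_)
open import Relation.Nullary.Decidable using (⌊_⌋)

-- A brick is determined by its long axis d ∈ Fin 3 (the axis along which
-- it has length 3) and its minimal corner (x , y , z) with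
-- x < k, y < m, z < n.  Distinct (d, corner)
-- give distinct boxes, so a set of bricks is a Boolean selection
-- indexed by (d , x , y , z).

Selection : ℕ → ℕ → ℕ → Set
Selection k m n = Vec (Vec (Vec (Vec Bool n) m) k) 3

sel : ∀ {k m n} → Selection k m n → Fin 3 → Fin k → Fin m → Fin n → Bool
sel S d x y z = lookup (lookup (lookup (lookup S d) x) y) z

len : Fin 3 → Fin 3 → ℕ
len d c = if ⌊ d ≟F c ⌋ then 3 else 1

inRange : ℕ → ℕ → ℕ → Bool
inRange x i L = (x ≤ᵇ i) ∧ (i <ᵇ x + L)

covers : Fin 3 → ℕ → ℕ → ℕ → ℕ → ℕ → ℕ → Bool
covers d x y z i j l =
  inRange x i (len d f0) ∧ inRange y j (len d (fs f0)) ∧ inRange z l (len d (fs (fs f0)))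

fits : ℕ → ℕ → ℕ → Fin 3 → ℕ → ℕ → ℕ → Bool
fits k m n d x y z =
  (x + len d f0 ≤ᵇ k) ∧ (y + len d (fs f0) ≤ᵇ m) ∧ (z + len d (fs (fs f0)) ≤ᵇ n)

allBricks : ∀ k m n → List (Fin 3 × Fin k × Fin m × Fin n)
allBricks k m n = L.cartesianProduct (allFin 3)
  (L.cartesianProduct (allFin k) (L.cartesianProduct (allFin m) (allFin n)))

allCells : ∀ k m n → List (Fin k × Fin m × Fin n)
allCells k m n = L.cartesianProduct (allFin k) (L.cartesianProduct (allFin m) (allFin n))

coverCount : ∀ {k m n} → Selection k m n → ℕ → ℕ → ℕ → ℕ
coverCount {k} {m} {n} S i j l = sum (map f (allBricks k m n))
  where
  f : Fin 3 × Fin k × Fin m × Fin n → ℕ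
  f (d , x , y , z) =
    if sel S d x y z ∧ covers d (toℕ x) (toℕ y) (toℕ z) i j l then 1 else 0

isTiling : ∀ {k m n} → Selection k m n → Bool
isTiling {k} {m} {n} S =
  and (map okBrick (allBricks k m n)) ∧ and (map okCell (allCells k m n))
  where
  okBrick : Fin 3 × Fin k × Fin m × Fin n → Bool
  okBrick (d , x , y , z) =
    if sel S d x y z then fits k m n d (toℕ x) (toℕ y) (toℕ z) else true
  okCell : Fin k × Fin m × Fin n → Bool
  okCell (i , j , l) = coverCount S (toℕ i) (toℕ j) (toℕ l) ≡ᵇ 1

Tiling : ℕ → ℕ → ℕ → Set
Tiling k m n = Σ (Selection k m n) (λ S → T (isTiling S))

-- Formal power series with integer coefficients, given by their
-- coefficient function ℕ → ℤ; polynomials as coefficient lists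
-- (constant term first).

coeff : List ℤ → ℕ → ℤ
coeff []       N       = + 0
coeff (c ∷ cs) zero    = c
coeff (c ∷ cs) (suc N) = coeff cs N

-- product polynomial × power series:  (c + z·p)·a
mulPS : List ℤ → (ℕ → ℤ) → (ℕ → ℤ)
mulPS []       a N       = + 0
mulPS (c ∷ p)  a zero    = c *ℤ a zero
mulPS (c ∷ p)  a (suc N) = c *ℤ a (suc N) +ℤ mulPS p a N

-- substitute z ↦ z³ :  Σ cᵢ wⁱ ↦ Σ cᵢ z^{3i}
spread3 : List ℤ → List ℤ
spread3 []       = []
spread3 (c ∷ cs) = c ∷ + 0 ∷ + 0 ∷ spread3 cs

-- numerator   1 - w - 2w² - 4w³ + w⁴ - w⁵ + w⁶ - w⁷      (w = z³)
numW : List ℤ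
numW = + 1 ∷ -[1+ 0 ] ∷ -[1+ 1 ] ∷ -[1+ 3 ] ∷ + 1 ∷ -[1+ 0 ] ∷ + 1 ∷ -[1+ 0 ] ∷ []

den1W : List ℤ
den1W = + 1 ∷ -[1+ 0 ] ∷ []

-- second factor  1 - 2w - 2w² - 15w³ - 17w⁴ - 6w⁵ + w⁶ - 3w⁷ - w⁹
den2W : List ℤ
den2W = + 1 ∷ -[1+ 1 ] ∷ -[1+ 1 ] ∷ -[1+ 14 ] ∷ -[1+ 16 ] ∷ -[1+ 5 ] ∷ + 1
      ∷ -[1+ 2 ] ∷ + 0 ∷ -[1+ 0 ] ∷ []

-- Cut the 3 × 3 × n box into n unit slabs along its long axis. Bricks along the first two axes lie inside one
-- slab; a brick along the third axis started in some slab also fills its column in the next two slabs. So a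
-- tiling is built slab by slab, and all that one slab passes on to the rest is a profile: for each of the nine
-- columns, how many further slabs are already filled (0, 1 or 2). The tilings are thus counted by walks in a
-- transfer graph on profiles, with 51 states reachable from the flat profile. Multiplying the series of any
-- state by the denominator D gives a polynomial of degree below 35: this is checked numerically for the
-- coefficients 35, 36, 37 of all states at once, and it propagates to every higher coefficient because the
-- state series obey the transfer recurrence a_σ(k + 3) = Σ_τ a_τ(k), while beyond the degree 30 of D the
-- coefficients of D · a commute with shifting a. The numerator is read off from the first 35 coefficients.
module Submission where

open import Defs

open import Level using (0ℓ)
open import Data.Bool using (Bool; true; false; _∧_; not; if_then_else_; T)
open import Data.Bool.ListAction using (all)
open import Data.Bool.Properties using (T-irrelevant; T-∧; ∧-comm; ∧-zeroʳ)
open import Data.Empty using (⊥-elim)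
open import Data.Empty.Polymorphic using (⊥)
open import Data.Fin using (Fin; zero; suc; toℕ; fromℕ<; #_)
open import Data.Fin.Patterns using (0F; 1F; 2F)
open import Data.Fin.Permutation using (↔⇒≡)
open import Data.Fin.Properties using (+↔⊎; toℕ-fromℕ<; toℕ≤pred[n])
open import Data.Integer using (ℤ; +_) renaming (_+_ to _+ℤ_; _*_ to _*ℤ_)
import Data.Integer.Properties as ℤ
open import Algebra.Properties.CommutativeSemigroup ℤ.+-commutativeSemigroup using (interchange)
open import Data.List as List using (List; []; _∷_; map; _++_; concatMap; filterᵇ; allFin; cartesianProduct)
open import Data.List.Membership.Propositional using (_∈_)
open import Data.List.Membership.Propositional.Properties using (∈-allFin; ∈-cartesianProduct⁺)
open import Data.List.Properties using (map-++; map-∘; map-cong)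
open import Data.List.Relation.Unary.All as All using (All)
open import Data.List.Relation.Unary.All.Properties using (all⁺; all⁻)
open import Data.Nat using (ℕ; zero; suc; pred; _+_; _∸_; _*_; _≤_; _<_; z≤n; s≤s; _≤ᵇ_; _<ᵇ_; _≡ᵇ_)
open import Data.Nat.Divisibility using (_∣_; _∣?_; divides; ∣m∣n⇒∣m+n; ∣-refl)
open import Data.Nat.ListAction using (sum)
open import Data.Nat.ListAction.Properties using (sum-++)
open import Data.Nat.Properties
  using ( +-identityʳ; +-comm; +-assoc; *-suc; *-comm; +-0-commutativeMonoid
        ; ≤-refl; ≤-trans; <⇒≤; +-monoʳ-≤; m≤n⇒m≤1+n; m≤n⇒m≤o+n; _<?_; ≮⇒≥; m+[n∸m]≡n
        ; <⇒<ᵇ; <ᵇ⇒<; ≤ᵇ⇒≤; ≤⇒≤ᵇ; ≡ᵇ⇒≡; ≡⇒≡ᵇ )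
open import Data.Nat.Tactic.RingSolver using (solve-∀)
open import Algebra.Properties.CommutativeMonoid.Sum +-0-commutativeMonoid
  using (∑-distrib-+; sum-cong-≗; sum-replicate-zero) renaming (sum to ∑)
open import Data.Product using (Σ; _×_; _,_; proj₁; proj₂)
open import Data.Product.Function.Dependent.Propositional using (Σ-↔)
open import Data.Product.Function.NonDependent.Propositional using (_×-↔_)
open import Data.Sum using (_⊎_; inj₁; inj₂)
open import Data.Sum.Function.Propositional using (_⊎-↔_)
open import Data.Unit using (tt)
open import Data.Vec as Vec using (Vec; []; _∷_; lookup; replicate; tabulate; zipWith; head; tail)
open import Data.Vec.Properties using (lookup-zipWith; lookup-replicate; lookup∘tabulate)
open import Function using (_∘_)
open import Function.Bundles using (_↔_; _⇔_; mk↔ₛ′; mk⇔; Inverse; Equivalence)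
open import Function.Properties.Inverse using (↔-refl; ↔-sym; ↔-trans)
open import Function.Related.Propositional using (module EquationalReasoning)
open import Function.Related.TypeIsomorphisms using (⊎-assoc; ⊎-identityˡ; ⊎-identityʳ; Σ-assoc)
open import Relation.Nullary using (¬_; yes; no)
open import Relation.Binary.PropositionalEquality
  using (_≡_; refl; sym; trans; cong; cong₂; subst; module ≡-Reasoning)

private variable
  A B C : Set

-- Counting through type isomorphisms

Coproduct : List A → (A → Set) → Set
Coproduct []       P = ⊥
Coproduct (x ∷ xs) P = P x ⊎ Coproduct xs P

Coproduct-cong : ∀ (xs : List A) {P Q : A → Set} → (∀ a → P a ↔ Q a) → Coproduct xs P ↔ Coproduct xs Q
Coproduct-cong []       e = ↔-refl
Coproduct-cong (x ∷ xs) e = e x ⊎-↔ Coproduct-cong xs e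

Coproduct-++ : ∀ (xs ys : List A) {P : A → Set} → Coproduct (xs ++ ys) P ↔ (Coproduct xs P ⊎ Coproduct ys P)
Coproduct-++ []       ys = ↔-sym (⊎-identityˡ 0ℓ _)
Coproduct-++ (x ∷ xs) ys = ↔-trans (↔-refl ⊎-↔ Coproduct-++ xs ys) (↔-sym (⊎-assoc 0ℓ _ _ _))

Coproduct-map : ∀ (f : A → B) (xs : List A) {P : B → Set} → Coproduct (map f xs) P ↔ Coproduct xs (P ∘ f)
Coproduct-map f []       = ↔-refl
Coproduct-map f (x ∷ xs) = ↔-refl ⊎-↔ Coproduct-map f xs

Coproduct-concatMap : ∀ (f : A → List B) (xs : List A) {P : B → Set} →
  Coproduct (concatMap f xs) P ↔ Coproduct xs (λ a → Coproduct (f a) P)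
Coproduct-concatMap f []       = ↔-refl
Coproduct-concatMap f (x ∷ xs) {P} = begin
  Coproduct (f x ++ concatMap f xs) P                        ↔⟨ Coproduct-++ (f x) (concatMap f xs) ⟩
  (Coproduct (f x) P ⊎ Coproduct (concatMap f xs) P)         ↔⟨ ↔-refl ⊎-↔ Coproduct-concatMap f xs ⟩
  (Coproduct (f x) P ⊎ Coproduct xs (λ a → Coproduct (f a) P)) ∎
  where open EquationalReasoning

Coproduct-Fin : ∀ (g : A → ℕ) (xs : List A) → Coproduct xs (Fin ∘ g) ↔ Fin (sum (map g xs))
Coproduct-Fin g []       = mk↔ₛ′ (λ ()) (λ ()) (λ ()) (λ ())
Coproduct-Fin g (x ∷ xs) = begin
  (Fin (g x) ⊎ Coproduct xs (Fin ∘ g)) ↔⟨ ↔-refl ⊎-↔ Coproduct-Fin g xs ⟩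
  (Fin (g x) ⊎ Fin (sum (map g xs)))   ↔⟨ +↔⊎ ⟨
  Fin (g x + sum (map g xs))         ∎
  where open EquationalReasoning

Σ-T-≡ : (p : A → Bool) {a a′ : A} {u : T (p a)} {v : T (p a′)} → a ≡ a′ →
  _≡_ {A = Σ A (T ∘ p)} (a , u) (a′ , v)
Σ-T-≡ p refl = cong (_ ,_) (T-irrelevant _ _)

Σ-T-↔ : (e : A ↔ B) {p : A → Bool} {q : B → Bool} →
  (∀ a → T (p a) → T (q (Inverse.to e a))) → (∀ b → T (q b) → T (p (Inverse.from e b))) →
  Σ A (T ∘ p) ↔ Σ B (T ∘ q)
Σ-T-↔ e {p} {q} p⇒q q⇒p = mk↔ₛ′
  (λ (a , u) → Inverse.to e a , p⇒q a u)
  (λ (b , v) → Inverse.from e b , q⇒p b v)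
  (λ (b , v) → Σ-T-≡ q (Inverse.strictlyInverseˡ e b))
  (λ (a , u) → Σ-T-≡ p (Inverse.strictlyInverseʳ e a))

Σ-T-split : (p : A → Bool) (c : Bool) (q : A → Bool) → (∀ a → T (p a) ⇔ (T c × T (q a))) →
  Σ A (T ∘ p) ↔ (T c × Σ A (T ∘ q))
Σ-T-split p c q p⇔c×q = mk↔ₛ′
  (λ (a , u) → proj₁ (to a u) , a , proj₂ (to a u))
  (λ (w , a , v) → a , from a (w , v))
  (λ (w , a , v) → cong₂ (λ w′ v′ → w′ , a , v′) (T-irrelevant _ _) (T-irrelevant _ _))
  (λ (a , u) → cong (a ,_) (T-irrelevant _ _))
  where
  to : ∀ a → T (p a) → T c × T (q a)
  to a = Equivalence.to (p⇔c×q a)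
  from : ∀ a → T c × T (q a) → T (p a)
  from a = Equivalence.from (p⇔c×q a)

T-true-× : {X : Set} → (T true × X) ↔ X
T-true-× = mk↔ₛ′ proj₂ (tt ,_) (λ _ → refl) (λ _ → refl)

T-false-× : {X : Set} → (T false × X) ↔ ⊥ {0ℓ}
T-false-× = mk↔ₛ′ (λ ()) (λ ()) (λ ()) (λ ())

T-∧-× : ∀ (x y : Bool) {X : Set} → (T (x ∧ y) × X) ↔ (T x × (T y × X))
T-∧-× true  y = ↔-sym T-true-×
T-∧-× false y = ↔-trans T-false-× (↔-sym T-false-×)

Σ-T-× : ∀ (x : Bool) {P : A → Set} → Σ A (λ a → T x × P a) ↔ (T x × Σ A P)
Σ-T-× x = mk↔ₛ′ (λ (a , u , w) → u , a , w) (λ (u , a , w) → a , u , w) (λ _ → refl) (λ _ → refl)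

Σ-Vec-∷ : ∀ {k} {P : Vec A (suc k) → Set} → Σ (Vec A (suc k)) P ↔ Σ A (λ a → Σ (Vec A k) (λ as → P (a ∷ as)))
Σ-Vec-∷ = mk↔ₛ′ (λ { (a ∷ as , w) → a , as , w }) (λ (a , as , w) → a ∷ as , w)
  (λ _ → refl) (λ { (a ∷ as , w) → refl })

Σ-Vec-[] : {P : Vec A 0 → Set} → Σ (Vec A 0) P ↔ P []
Σ-Vec-[] = mk↔ₛ′ (λ { ([] , w) → w }) ([] ,_) (λ _ → refl) (λ { ([] , w) → refl })

-- xs lists the solutions of p, each exactly once; stated for every family Q so that enumerations compose.
Enumerates : (A → Bool) → List A → Set₁
Enumerates {A} p xs = (Q : A → Set) → Σ A (λ a → T (p a) × Q a) ↔ Coproduct xs Q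

T-≡-× : {x y : Bool} {X : Set} → x ≡ y → (T x × X) ↔ (T y × X)
T-≡-× refl = ↔-refl

Enumerates-cong : {p q : A → Bool} {xs : List A} → (∀ a → p a ≡ q a) → Enumerates p xs → Enumerates q xs
Enumerates-cong p≗q enum Q = ↔-trans (Σ-↔ ↔-refl (λ {a} → T-≡-× (sym (p≗q a)))) (enum Q)

bools : List Bool
bools = false ∷ true ∷ []

enumerates-bools : Enumerates (λ _ → true) bools
enumerates-bools Q = mk↔ₛ′
  (λ { (false , _ , w) → inj₁ w ; (true , _ , w) → inj₂ (inj₁ w) })
  (λ { (inj₁ w) → false , tt , w ; (inj₂ (inj₁ w)) → true , tt , w })
  (λ { (inj₁ w) → refl ; (inj₂ (inj₁ w)) → refl })
  (λ { (false , _ , w) → refl ; (true , _ , w) → refl })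

Coproduct-filterᵇ : ∀ (p : A → Bool) (xs : List A) {Q : A → Set} →
  Coproduct xs (λ a → T (p a) × Q a) ↔ Coproduct (filterᵇ p xs) Q
Coproduct-filterᵇ p []       = ↔-refl
Coproduct-filterᵇ p (x ∷ xs) with p x
... | true  = T-true-× ⊎-↔ Coproduct-filterᵇ p xs
... | false = ↔-trans (T-false-× ⊎-↔ Coproduct-filterᵇ p xs) (⊎-identityˡ 0ℓ _)

enumerates-filterᵇ : ∀ (p : A → Bool) {xs : List A} → Enumerates (λ _ → true) xs → Enumerates p (filterᵇ p xs)
enumerates-filterᵇ {A} p {xs} everything Q = begin
  Σ A (λ a → T (p a) × Q a)                ↔⟨ Σ-↔ ↔-refl (↔-sym T-true-×) ⟩
  Σ A (λ a → T true × (T (p a) × Q a))     ↔⟨ everything _ ⟩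
  Coproduct xs (λ a → T (p a) × Q a)       ↔⟨ Coproduct-filterᵇ p xs ⟩
  Coproduct (filterᵇ p xs) Q               ∎
  where open EquationalReasoning

allOf : {K : Set} → (K → A → Bool) → ∀ {k} → Vec K k → Vec A k → Bool
allOf pred []       []       = true
allOf pred (κ ∷ κs) (a ∷ as) = pred κ a ∧ allOf pred κs as

choices : {K : Set} → (K → List A) → ∀ {k} → Vec K k → List (Vec A k)
choices list []       = [] ∷ []
choices list (κ ∷ κs) = concatMap (λ a → map (a ∷_) (choices list κs)) (list κ)

enumerates-choices : {K : Set} (pred : K → A → Bool) (list : K → List A) → (∀ κ → Enumerates (pred κ) (list κ)) →
  ∀ {k} (κs : Vec K k) → Enumerates (allOf pred κs) (choices list κs)
enumerates-choices pred list enum []       Q = ↔-trans Σ-Vec-[] (↔-trans T-true-× (↔-sym (⊎-identityʳ 0ℓ _)))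
enumerates-choices {A} pred list enum (κ ∷ κs) Q = begin
  Σ (Vec A _) (λ as → T (allOf pred (κ ∷ κs) as) × Q as)
    ↔⟨ Σ-Vec-∷ ⟩
  Σ A (λ a → Σ (Vec A _) (λ as → T (pred κ a ∧ allOf pred κs as) × Q (a ∷ as)))
    ↔⟨ Σ-↔ ↔-refl (λ {a} → ↔-trans (Σ-↔ ↔-refl (T-∧-× (pred κ a) _)) (Σ-T-× (pred κ a))) ⟩
  Σ A (λ a → T (pred κ a) × Σ (Vec A _) (λ as → T (allOf pred κs as) × Q (a ∷ as)))
    ↔⟨ enum κ _ ⟩
  Coproduct (list κ) (λ a → Σ (Vec A _) (λ as → T (allOf pred κs as) × Q (a ∷ as)))
    ↔⟨ Coproduct-cong (list κ) (λ a → enumerates-choices pred list enum κs (Q ∘ (a ∷_))) ⟩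
  Coproduct (list κ) (λ a → Coproduct (choices list κs) (Q ∘ (a ∷_)))
    ↔⟨ Coproduct-cong (list κ) (λ a → Coproduct-map (a ∷_) (choices list κs)) ⟨
  Coproduct (list κ) (λ a → Coproduct (map (a ∷_) (choices list κs)) Q)
    ↔⟨ Coproduct-concatMap (λ a → map (a ∷_) (choices list κs)) (list κ) ⟨
  Coproduct (choices list (κ ∷ κs)) Q
    ∎
  where open EquationalReasoning

allOf-true : ∀ {k} (as : Vec A k) → allOf (λ _ _ → true) (replicate k tt) as ≡ true
allOf-true []       = refl
allOf-true (a ∷ as) = allOf-true as

enumerates-Vec : {xs : List A} → Enumerates (λ _ → true) xs →
  ∀ k → Enumerates (λ _ → true) (choices (λ _ → xs) (replicate k tt))
enumerates-Vec enum k =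
  Enumerates-cong allOf-true (enumerates-choices (λ _ _ → true) _ (λ _ → enum) (replicate k tt))

enumerates-× : {p : A → Bool} {q : A → B → Bool} {xs : List A} {ys : A → List B} →
  Enumerates p xs → (∀ a → Enumerates (q a) (ys a)) →
  Enumerates (λ w → p (proj₁ w) ∧ q (proj₁ w) (proj₂ w)) (concatMap (λ a → map (a ,_) (ys a)) xs)
enumerates-× {A} {B} {p} {q} {xs} {ys} enum-p enum-q Q = begin
  Σ (A × B) (λ w → T (p (proj₁ w) ∧ q (proj₁ w) (proj₂ w)) × Q w)
    ↔⟨ Σ-assoc ⟩
  Σ A (λ a → Σ B (λ b → T (p a ∧ q a b) × Q (a , b)))
    ↔⟨ Σ-↔ ↔-refl (λ {a} → ↔-trans (Σ-↔ ↔-refl (T-∧-× (p a) _)) (Σ-T-× (p a))) ⟩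
  Σ A (λ a → T (p a) × Σ B (λ b → T (q a b) × Q (a , b)))
    ↔⟨ enum-p _ ⟩
  Coproduct xs (λ a → Σ B (λ b → T (q a b) × Q (a , b)))
    ↔⟨ Coproduct-cong xs (λ a → enum-q a (Q ∘ (a ,_))) ⟩
  Coproduct xs (λ a → Coproduct (ys a) (Q ∘ (a ,_)))
    ↔⟨ Coproduct-cong xs (λ a → Coproduct-map (a ,_) (ys a)) ⟨
  Coproduct xs (λ a → Coproduct (map (a ,_) (ys a)) Q)
    ↔⟨ Coproduct-concatMap (λ a → map (a ,_) (ys a)) xs ⟨
  Coproduct (concatMap (λ a → map (a ,_) (ys a)) xs) Q
    ∎
  where open EquationalReasoning

noneOf : ∀ {k} → Vec Bool k → Bool
noneOf []       = true
noneOf (b ∷ bs) = not b ∧ noneOf bs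

Σ-noneOf : ∀ k {X : Set} → Σ (Vec Bool k) (λ bs → T (noneOf bs) × X) ↔ X
Σ-noneOf zero          = ↔-trans Σ-Vec-[] T-true-×
Σ-noneOf (suc k) {X} = begin
  Σ (Vec Bool (suc k)) (λ bs → T (noneOf bs) × X)
    ↔⟨ Σ-Vec-∷ ⟩
  Σ Bool (λ b → Σ (Vec Bool k) (λ bs → T (not b ∧ noneOf bs) × X))
    ↔⟨ head-false ⟩
  Σ (Vec Bool k) (λ bs → T (noneOf bs) × X)
    ↔⟨ Σ-noneOf k ⟩
  X ∎
  where
  open EquationalReasoning
  head-false : Σ Bool (λ b → Σ (Vec Bool k) (λ bs → T (not b ∧ noneOf bs) × X))
             ↔ Σ (Vec Bool k) (λ bs → T (noneOf bs) × X)
  head-false = mk↔ₛ′ (λ { (false , w) → w ; (true , _ , () , _) }) (false ,_)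
    (λ _ → refl) (λ { (false , w) → refl ; (true , _ , () , _) })

noneOf⇒replicate : ∀ {k} (bs : Vec Bool k) → T (noneOf bs) → bs ≡ replicate k false
noneOf⇒replicate []           _ = refl
noneOf⇒replicate (false ∷ bs) t = cong (false ∷_) (noneOf⇒replicate bs t)

infixr 4 _∧ᵀ_
_∧ᵀ_ : ∀ {a b} → T a → T b → T (a ∧ b)
_∧ᵀ_ {true} _ t = t

T-allOf⇔ : {K : Set} (pred : K → A → Bool) → ∀ {k} (κs : Vec K k) (as : Vec A k) →
  T (allOf pred κs as) ⇔ (∀ i → T (pred (lookup κs i) (lookup as i)))
T-allOf⇔ pred []       []       = mk⇔ (λ _ ()) (λ _ → tt)
T-allOf⇔ pred (κ ∷ κs) (a ∷ as) = mk⇔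
  (λ t → let (t₀ , t₁) = Equivalence.to (T-∧ {pred κ a}) t in
    λ { zero → t₀ ; (suc i) → Equivalence.to (T-allOf⇔ pred κs as) t₁ i })
  (λ h → h zero ∧ᵀ Equivalence.from (T-allOf⇔ pred κs as) (h ∘ suc))

T-all⇔ : (p : A → Bool) {xs : List A} → (∀ a → a ∈ xs) → T (all p xs) ⇔ (∀ a → T (p a))
T-all⇔ p {xs} complete = mk⇔
  (λ t a → All.lookup (all⁺ p xs t) (complete a))
  (λ h → all⁻ p {xs} (All.tabulate (λ {a} _ → h a)))

sum-map-cartesianProduct : (f : A × B → ℕ) (xs : List A) (ys : List B) →
  sum (map f (cartesianProduct xs ys)) ≡ sum (map (λ x → sum (map (λ y → f (x , y)) ys)) xs)
sum-map-cartesianProduct f []       ys = refl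
sum-map-cartesianProduct f (x ∷ xs) ys = begin
  sum (map f (map (x ,_) ys ++ cartesianProduct xs ys))
    ≡⟨ cong sum (map-++ f (map (x ,_) ys) _) ⟩
  sum (map f (map (x ,_) ys) ++ map f (cartesianProduct xs ys))
    ≡⟨ sum-++ (map f (map (x ,_) ys)) _ ⟩
  sum (map f (map (x ,_) ys)) + sum (map f (cartesianProduct xs ys))
    ≡⟨ cong₂ _+_ (cong sum (sym (map-∘ ys))) (sum-map-cartesianProduct f xs ys) ⟩
  sum (map (λ y → f (x , y)) ys) + sum (map (λ x → sum (map (λ y → f (x , y)) ys)) xs) ∎
  where open ≡-Reasoning

sum-map-tabulate : ∀ {k} (g : Fin k → A) (f : A → ℕ) → sum (map f (List.tabulate g)) ≡ ∑ (f ∘ g)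
sum-map-tabulate {k = zero}  g f = refl
sum-map-tabulate {k = suc k} g f = cong (λ s → f (g zero) + s) (sum-map-tabulate (g ∘ suc) f)

sum-map-allFin : ∀ {k} (f : Fin k → ℕ) → sum (map f (allFin k)) ≡ ∑ f
sum-map-allFin f = sum-map-tabulate (λ i → i) f

sum-map-allFin× : ∀ {k} (f : Fin k × B → ℕ) (ys : List B) →
  sum (map f (cartesianProduct (allFin k) ys)) ≡ ∑ (λ x → sum (map (λ y → f (x , y)) ys))
sum-map-allFin× {k = k} f ys =
  trans (sum-map-cartesianProduct f (allFin k) ys) (sum-map-allFin (λ x → sum (map (λ y → f (x , y)) ys)))

sum-map-allFin⁴ : ∀ {a b c d} (f : Fin a × Fin b × Fin c × Fin d → ℕ) →
  sum (map f (cartesianProduct (allFin a) (cartesianProduct (allFin b) (cartesianProduct (allFin c) (allFin d)))))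
    ≡ ∑ λ w → ∑ λ x → ∑ λ y → ∑ λ z → f (w , x , y , z)
sum-map-allFin⁴ f =
  trans (sum-map-allFin× f _) (sum-cong-≗ λ w →
  trans (sum-map-allFin× (λ q → f (w , q)) _) (sum-cong-≗ λ x →
  trans (sum-map-allFin× (λ q → f (w , x , q)) _) (sum-cong-≗ λ y →
  sum-map-allFin (λ z → f (w , x , y , z)))))

∑³-distrib-+ : ∀ {a b c} (f g : Fin a → Fin b → Fin c → ℕ) →
  (∑ λ d → ∑ λ x → ∑ λ y → f d x y + g d x y)
    ≡ (∑ λ d → ∑ λ x → ∑ λ y → f d x y) + (∑ λ d → ∑ λ x → ∑ λ y → g d x y)
∑³-distrib-+ f g =
  trans (sum-cong-≗ λ d → trans (sum-cong-≗ λ x → ∑-distrib-+ (f d x) (g d x)) (∑-distrib-+ (∑ ∘ f d) (∑ ∘ g d)))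
    (∑-distrib-+ (λ d → ∑ (∑ ∘ f d)) (λ d → ∑ (∑ ∘ g d)))

∑-zero : ∀ {k} (f : Fin k → ℕ) → (∀ i → f i ≡ 0) → ∑ f ≡ 0
∑-zero {k} f f≗0 = trans (sum-cong-≗ f≗0) (sum-replicate-zero k)

<ᵇ-suc : ∀ m n → (m <ᵇ suc n) ≡ (m ≤ᵇ n)
<ᵇ-suc zero    n = refl
<ᵇ-suc (suc m) n = refl

tabulate-≡⇒≗ : ∀ {A : Set} {k} {f g : Fin k → A} → tabulate f ≡ tabulate g → ∀ i → f i ≡ g i
tabulate-≡⇒≗ {f = f} {g} eq i = trans (sym (lookup∘tabulate f i)) (trans (cong (λ v → lookup v i) eq) (lookup∘tabulate g i))

Vec-allEqual : ∀ {A : Set} {k} → (∀ (a b : A) → a ≡ b) → (u w : Vec A k) → u ≡ w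
Vec-allEqual eq []      []      = refl
Vec-allEqual eq (a ∷ u) (b ∷ w) = cong₂ _∷_ (eq a b) (Vec-allEqual eq u w)

zipWith-map-map : ∀ {k} (g : A → B → C) (f₁ : C → A) (f₂ : C → B) → (∀ c → g (f₁ c) (f₂ c) ≡ c) →
  (cs : Vec C k) → zipWith g (Vec.map f₁ cs) (Vec.map f₂ cs) ≡ cs
zipWith-map-map g f₁ f₂ h []       = refl
zipWith-map-map g f₁ f₂ h (c ∷ cs) = cong₂ _∷_ (h c) (zipWith-map-map g f₁ f₂ h cs)

map-zipWith₁ : ∀ {k} (g : A → B → C) (f : C → A) → (∀ a b → f (g a b) ≡ a) →
  (as : Vec A k) (bs : Vec B k) → Vec.map f (zipWith g as bs) ≡ as
map-zipWith₁ g f h []       []       = refl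
map-zipWith₁ g f h (a ∷ as) (b ∷ bs) = cong₂ _∷_ (h a b) (map-zipWith₁ g f h as bs)

map-zipWith₂ : ∀ {k} (g : A → B → C) (f : C → B) → (∀ a b → f (g a b) ≡ b) →
  (as : Vec A k) (bs : Vec B k) → Vec.map f (zipWith g as bs) ≡ bs
map-zipWith₂ g f h []       []       = refl
map-zipWith₂ g f h (a ∷ as) (b ∷ bs) = cong₂ _∷_ (h a b) (map-zipWith₂ g f h as bs)

-- Products of a polynomial with a power series

sumℤ : List ℤ → ℤ
sumℤ []       = + 0
sumℤ (x ∷ xs) = x +ℤ sumℤ xs

pos-sum : ∀ xs → + sum xs ≡ sumℤ (map +_ xs)
pos-sum []       = refl
pos-sum (x ∷ xs) = trans (ℤ.pos-+ x (sum xs)) (cong (+ x +ℤ_) (pos-sum xs))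

sumℤ-zero : ∀ {A : Set} (F : A → ℤ) ts → (∀ t → F t ≡ + 0) → sumℤ (map F ts) ≡ + 0
sumℤ-zero F []       F≗0 = refl
sumℤ-zero F (t ∷ ts) F≗0 = cong₂ _+ℤ_ (F≗0 t) (sumℤ-zero F ts F≗0)

mulPS-cong≤ : ∀ p {f g : ℕ → ℤ} N → (∀ k → k ≤ N → f k ≡ g k) → mulPS p f N ≡ mulPS p g N
mulPS-cong≤ []      N       f≗g = refl
mulPS-cong≤ (c ∷ p) zero    f≗g = cong (c *ℤ_) (f≗g 0 z≤n)
mulPS-cong≤ (c ∷ p) (suc N) f≗g =
  cong₂ _+ℤ_ (cong (c *ℤ_) (f≗g (suc N) ≤-refl)) (mulPS-cong≤ p N (λ k k≤N → f≗g k (m≤n⇒m≤1+n k≤N)))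

mulPS-cong : ∀ p {f g : ℕ → ℤ} → (∀ k → f k ≡ g k) → ∀ N → mulPS p f N ≡ mulPS p g N
mulPS-cong p f≗g N = mulPS-cong≤ p N (λ k _ → f≗g k)

mulPS-+ : ∀ p (f g : ℕ → ℤ) N → mulPS p (λ k → f k +ℤ g k) N ≡ mulPS p f N +ℤ mulPS p g N
mulPS-+ []      f g N       = refl
mulPS-+ (c ∷ p) f g zero    = ℤ.*-distribˡ-+ c (f 0) (g 0)
mulPS-+ (c ∷ p) f g (suc N) = trans (cong₂ _+ℤ_ (ℤ.*-distribˡ-+ c (f (suc N)) (g (suc N))) (mulPS-+ p f g N))
  (interchange (c *ℤ f (suc N)) (c *ℤ g (suc N)) (mulPS p f N) (mulPS p g N))

mulPS-zero : ∀ p N → mulPS p (λ _ → + 0) N ≡ + 0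
mulPS-zero []      N       = refl
mulPS-zero (c ∷ p) zero    = ℤ.*-zeroʳ c
mulPS-zero (c ∷ p) (suc N) = cong₂ _+ℤ_ (ℤ.*-zeroʳ c) (mulPS-zero p N)

mulPS-sumℤ : ∀ {A : Set} p (F : A → ℕ → ℤ) ts N →
  mulPS p (λ k → sumℤ (map (λ t → F t k) ts)) N ≡ sumℤ (map (λ t → mulPS p (F t) N) ts)
mulPS-sumℤ p F []       N = mulPS-zero p N
mulPS-sumℤ p F (t ∷ ts) N =
  trans (mulPS-+ p (F t) (λ k → sumℤ (map (λ t → F t k) ts)) N) (cong (mulPS p (F t) N +ℤ_) (mulPS-sumℤ p F ts N))

mulPS-0 : ∀ p (f : ℕ → ℤ) → mulPS p f 0 ≡ coeff p 0 *ℤ f 0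
mulPS-0 []      f = refl
mulPS-0 (c ∷ p) f = refl

mulPS-suc : ∀ p (f : ℕ → ℤ) N → mulPS p f (suc N) ≡ mulPS p (f ∘ suc) N +ℤ coeff p (suc N) *ℤ f 0
mulPS-suc []      f N       = refl
mulPS-suc (c ∷ p) f zero    = cong (c *ℤ f 1 +ℤ_) (mulPS-0 p f)
mulPS-suc (c ∷ p) f (suc N) = trans (cong (c *ℤ f (suc (suc N)) +ℤ_) (mulPS-suc p f N))
  (sym (ℤ.+-assoc (c *ℤ f (suc (suc N))) (mulPS p (f ∘ suc) N) (coeff p (suc N) *ℤ f 0)))

-- Partial tilings

-- A profile records, for each column (i , j) of the 3 × 3 cross-section, how many of the next slabs are already
-- filled by a brick along the third axis that started in an earlier slab.
Profile : Set
Profile = Vec (Vec ℕ 3) 3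

depth : Profile → Fin 3 → Fin 3 → ℕ
depth σ i j = lookup (lookup σ i) j

bit : Bool → ℕ
bit b = if b then 1 else 0

pending : Profile → Fin 3 → Fin 3 → ℕ → ℕ
pending σ i j l = bit (l <ᵇ depth σ i j)

flat : Profile
flat = replicate 3 (replicate 3 0)

brickFits : ∀ {n} → Selection 3 3 n → Fin 3 × Fin 3 × Fin 3 × Fin n → Bool
brickFits {n} S (d , x , y , z) = if sel S d x y z then fits 3 3 n d (toℕ x) (toℕ y) (toℕ z) else true

coveredOnce : ∀ {n} → Profile → Selection 3 3 n → Fin 3 × Fin 3 × Fin n → Bool
coveredOnce σ S (i , j , l) = coverCount S (toℕ i) (toℕ j) (toℕ l) + pending σ i j (toℕ l) ≡ᵇ 1

depthFits : ℕ → Profile → Fin 3 × Fin 3 → Bool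
depthFits n σ (i , j) = depth σ i j ≤ᵇ n

allBricksFit : ∀ {n} → Selection 3 3 n → Bool
allBricksFit {n} S = all (brickFits S) (allBricks 3 3 n)

allCoveredOnce : ∀ {n} → Profile → Selection 3 3 n → Bool
allCoveredOnce {n} σ S = all (coveredOnce σ S) (allCells 3 3 n)

allDepthsFit : ℕ → Profile → Bool
allDepthsFit n σ = all (depthFits n σ) (cartesianProduct (allFin 3) (allFin 3))

isPartialTiling : ∀ {n} → Profile → Selection 3 3 n → Bool
isPartialTiling {n} σ S = allBricksFit S ∧ (allCoveredOnce σ S ∧ allDepthsFit n σ)

PartialTiling : Profile → ℕ → Set
PartialTiling σ n = Σ (Selection 3 3 n) (T ∘ isPartialTiling σ)

record IsPartialTiling {n} (σ : Profile) (S : Selection 3 3 n) : Set where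
  field
    bricks-fit   : ∀ d x y z → T (sel S d x y z) → T (fits 3 3 n d (toℕ x) (toℕ y) (toℕ z))
    covered-once : ∀ i j (l : Fin n) → coverCount S (toℕ i) (toℕ j) (toℕ l) + pending σ i j (toℕ l) ≡ 1
    depth≤       : ∀ i j → depth σ i j ≤ n

∈-allFin² : ∀ {k m} (p : Fin k × Fin m) → p ∈ cartesianProduct (allFin k) (allFin m)
∈-allFin² (x , y) = ∈-cartesianProduct⁺ (∈-allFin x) (∈-allFin y)

∈-allCells : ∀ {k m n} (c : Fin k × Fin m × Fin n) → c ∈ allCells k m n
∈-allCells (x , p) = ∈-cartesianProduct⁺ (∈-allFin x) (∈-allFin² p)

∈-allBricks : ∀ {k m n} (b : Fin 3 × Fin k × Fin m × Fin n) → b ∈ allBricks k m n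
∈-allBricks (d , c) = ∈-cartesianProduct⁺ (∈-allFin d) (∈-allCells c)

T-if⇔ : ∀ b {c} → T (if b then c else true) ⇔ (T b → T c)
T-if⇔ true  = mk⇔ (λ t _ → t) (λ f → f tt)
T-if⇔ false = mk⇔ (λ _ ()) (λ _ → tt)

all-brickFits⇔ : ∀ {n} (S : Selection 3 3 n) →
  T (all (brickFits S) (allBricks 3 3 n)) ⇔ (∀ d x y z → T (sel S d x y z) → T (fits 3 3 n d (toℕ x) (toℕ y) (toℕ z)))
all-brickFits⇔ S = mk⇔
  (λ t d x y z → Equivalence.to (T-if⇔ (sel S d x y z)) (Equivalence.to (T-all⇔ _ ∈-allBricks) t (d , x , y , z)))
  (λ h → Equivalence.from (T-all⇔ _ ∈-allBricks) (λ (d , x , y , z) → Equivalence.from (T-if⇔ (sel S d x y z)) (h d x y z)))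

isPartialTiling⇔ : ∀ {n} (σ : Profile) (S : Selection 3 3 n) → T (isPartialTiling σ S) ⇔ IsPartialTiling σ S
isPartialTiling⇔ {n} σ S = mk⇔
  (λ t → let (tb , tcd) = Equivalence.to (T-∧ {allBricksFit S}) t
             (tc , td)  = Equivalence.to (T-∧ {allCoveredOnce σ S}) tcd
         in record
    { bricks-fit   = Equivalence.to (all-brickFits⇔ S) tb
    ; covered-once = λ i j l → ≡ᵇ⇒≡ _ 1 (Equivalence.to (T-all⇔ (coveredOnce σ S) ∈-allCells) tc (i , j , l))
    ; depth≤       = λ i j → ≤ᵇ⇒≤ _ _ (Equivalence.to (T-all⇔ (depthFits n σ) ∈-allFin²) td (i , j))
    })
  (λ P → let open IsPartialTiling P in
       Equivalence.from (all-brickFits⇔ S) bricks-fit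
    ∧ᵀ Equivalence.from (T-all⇔ (coveredOnce σ S) ∈-allCells) (λ (i , j , l) → ≡⇒≡ᵇ _ 1 (covered-once i j l))
    ∧ᵀ Equivalence.from (T-all⇔ (depthFits n σ) ∈-allFin²) (λ (i , j) → ≤⇒≤ᵇ (depth≤ i j)))

depth-flat : ∀ i j → depth flat i j ≡ 0
depth-flat i j = trans (cong (λ row → lookup row j) (lookup-replicate i _)) (lookup-replicate j 0)

coveredOnce-flat : ∀ {n} (S : Selection 3 3 n) (i j : Fin 3) (l : Fin n) →
  coverCount S (toℕ i) (toℕ j) (toℕ l) + pending flat i j (toℕ l) ≡ coverCount S (toℕ i) (toℕ j) (toℕ l)
coveredOnce-flat S i j l rewrite depth-flat i j = +-identityʳ _

isTiling⇔ : ∀ {n} (S : Selection 3 3 n) → T (isTiling S) ⇔ IsPartialTiling flat S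
isTiling⇔ {n} S = mk⇔
  (λ t → let (tb , tc) = Equivalence.to (T-∧ {allBricksFit S}) t in record
    { bricks-fit   = Equivalence.to (all-brickFits⇔ S) tb
    ; covered-once = λ i j l → trans (coveredOnce-flat S i j l)
                       (≡ᵇ⇒≡ (cover i j l) 1 (Equivalence.to (T-all⇔ coveredOnceAlone ∈-allCells) tc (i , j , l)))
    ; depth≤       = λ i j → subst (_≤ n) (sym (depth-flat i j)) z≤n
    })
  (λ P → let open IsPartialTiling P in
       Equivalence.from (all-brickFits⇔ S) bricks-fit
    ∧ᵀ Equivalence.from (T-all⇔ coveredOnceAlone ∈-allCells) (λ (i , j , l) →
         ≡⇒≡ᵇ (cover i j l) 1 (trans (sym (coveredOnce-flat S i j l)) (covered-once i j l))))
  where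
  cover : Fin 3 → Fin 3 → Fin n → ℕ
  cover i j l = coverCount S (toℕ i) (toℕ j) (toℕ l)
  coveredOnceAlone : Fin 3 × Fin 3 × Fin n → Bool
  coveredOnceAlone (i , j , l) = cover i j l ≡ᵇ 1

Tiling↔PartialTiling-flat : ∀ n → Tiling 3 3 n ↔ PartialTiling flat n
Tiling↔PartialTiling-flat n = Σ-T-↔ ↔-refl
  (λ S → Equivalence.from (isPartialTiling⇔ flat S) ∘ Equivalence.to (isTiling⇔ S))
  (λ S → Equivalence.from (isTiling⇔ S) ∘ Equivalence.to (isPartialTiling⇔ flat S))

-- Splitting off the first slab

Layer : Set
Layer = Vec (Vec (Vec Bool 3) 3) 3

layerBit : Layer → Fin 3 → Fin 3 → Fin 3 → Bool
layerBit L d x y = lookup (lookup (lookup L d) x) y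

infixr 5 _◂_
_◂_ : ∀ {n} → Layer → Selection 3 3 n → Selection 3 3 (suc n)
L ◂ S = zipWith (zipWith (zipWith _∷_)) L S

sel-◂ : ∀ {n} (L : Layer) (S : Selection 3 3 n) d x y z →
  sel (L ◂ S) d x y z ≡ lookup (layerBit L d x y ∷ lookup (lookup (lookup S d) x) y) z
sel-◂ L S d x y z =
  trans (cong (λ t → lookup (lookup (lookup t x) y) z) (lookup-zipWith _ d L S))
  (trans (cong (λ t → lookup (lookup t y) z) (lookup-zipWith _ x (lookup L d) (lookup S d)))
    (cong (λ t → lookup t z) (lookup-zipWith _∷_ y (lookup (lookup L d) x) (lookup (lookup S d) x))))

sel-◂-zero : ∀ {n} (L : Layer) (S : Selection 3 3 n) d x y → sel (L ◂ S) d x y 0F ≡ layerBit L d x y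
sel-◂-zero L S d x y = sel-◂ L S d x y 0F

sel-◂-suc : ∀ {n} (L : Layer) (S : Selection 3 3 n) d x y z → sel (L ◂ S) d x y (suc z) ≡ sel S d x y z
sel-◂-suc L S d x y z = sel-◂ L S d x y (suc z)

Selection-suc↔ : ∀ {n} → Selection 3 3 (suc n) ↔ (Layer × Selection 3 3 n)
Selection-suc↔ = mk↔ₛ′
  (λ S → Vec.map (Vec.map (Vec.map head)) S , Vec.map (Vec.map (Vec.map tail)) S)
  (λ (L , S) → L ◂ S)
  (λ (L , S) → cong₂ _,_
    (map-zipWith₁ _ _ (map-zipWith₁ _ _ (map-zipWith₁ _ _ (λ _ _ → refl))) L S)
    (map-zipWith₂ _ _ (map-zipWith₂ _ _ (map-zipWith₂ _ _ (λ _ _ → refl))) L S))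
  (zipWith-map-map _ _ _ (zipWith-map-map _ _ _ (zipWith-map-map _ _ _ λ { (_ ∷ _) → refl })))

coverSum : ∀ {n} → Selection 3 3 n → ℕ → ℕ → ℕ → ℕ
coverSum S i j l =
  ∑ λ d → ∑ λ x → ∑ λ y → ∑ λ z → bit (covers d (toℕ x) (toℕ y) (toℕ z) i j l ∧ sel S d x y z)

coverCount≡coverSum : ∀ {n} (S : Selection 3 3 n) i j l → coverCount S i j l ≡ coverSum S i j l
coverCount≡coverSum {n} S i j l =
  trans (sum-map-allFin⁴ summand) (sum-cong-≗ λ d → sum-cong-≗ λ x → sum-cong-≗ λ y → sum-cong-≗ λ z →
  cong bit (∧-comm (sel S d x y z) (covers d (toℕ x) (toℕ y) (toℕ z) i j l)))
  where
  summand : Fin 3 × Fin 3 × Fin 3 × Fin n → ℕ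
  summand (d , x , y , z) = bit (sel S d x y z ∧ covers d (toℕ x) (toℕ y) (toℕ z) i j l)

layerCount : Layer → ℕ → ℕ → ℕ → ℕ
layerCount L i j l = ∑ λ d → ∑ λ x → ∑ λ y → bit (covers d (toℕ x) (toℕ y) 0 i j l ∧ layerBit L d x y)

shiftedSum : ∀ {n} → Selection 3 3 n → ℕ → ℕ → ℕ → ℕ
shiftedSum S i j l =
  ∑ λ d → ∑ λ x → ∑ λ y → ∑ λ z → bit (covers d (toℕ x) (toℕ y) (suc (toℕ z)) i j l ∧ sel S d x y z)

coverSum-◂ : ∀ {n} (L : Layer) (S : Selection 3 3 n) i j l →
  coverSum (L ◂ S) i j l ≡ layerCount L i j l + shiftedSum S i j l
coverSum-◂ L S i j l = trans
  (sum-cong-≗ λ d → sum-cong-≗ λ x → sum-cong-≗ λ y → cong₂ _+_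
    (cong (λ b → bit (covers d (toℕ x) (toℕ y) 0 i j l ∧ b)) (sel-◂-zero L S d x y))
    (sum-cong-≗ λ z → cong (λ b → bit (covers d (toℕ x) (toℕ y) (suc (toℕ z)) i j l ∧ b)) (sel-◂-suc L S d x y z)))
  (∑³-distrib-+ (λ d x y → bit (covers d (toℕ x) (toℕ y) 0 i j l ∧ layerBit L d x y))
     (λ d x y → ∑ λ z → bit (covers d (toℕ x) (toℕ y) (suc (toℕ z)) i j l ∧ sel S d x y z)))

covers-suc-zero : ∀ d x y z i j → covers d x y (suc z) i j 0 ≡ false
covers-suc-zero d x y z i j = trans (cong (inRange x i (len d 0F) ∧_) (∧-zeroʳ (inRange y j (len d 1F))))
  (∧-zeroʳ (inRange x i (len d 0F)))

covers-suc-suc : ∀ d x y z i j l → covers d x y (suc z) i j (suc l) ≡ covers d x y z i j l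
covers-suc-suc d x y z i j l =
  cong (λ t → inRange x i (len d 0F) ∧ (inRange y j (len d 1F) ∧ (t ∧ (l <ᵇ z + len d 2F))))
    (<ᵇ-suc z l)

fits-suc : ∀ n d x y z → fits 3 3 (suc n) d x y (suc z) ≡ fits 3 3 n d x y z
fits-suc n d x y z =
  cong (λ t → (x + len d 0F ≤ᵇ 3) ∧ ((y + len d 1F ≤ᵇ 3) ∧ t)) (<ᵇ-suc (z + len d 2F) n)

coverCount-◂-zero : ∀ {n} (L : Layer) (S : Selection 3 3 n) i j → coverCount (L ◂ S) i j 0 ≡ layerCount L i j 0
coverCount-◂-zero L S i j = trans (coverCount≡coverSum (L ◂ S) i j 0) (trans (coverSum-◂ L S i j 0)
  (trans (cong (λ s → layerCount L i j 0 + s) shifted≡0) (+-identityʳ _)))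
  where
  shifted≡0 : shiftedSum S i j 0 ≡ 0
  shifted≡0 = ∑-zero _ λ d → ∑-zero _ λ x → ∑-zero _ λ y → ∑-zero _ λ z →
    cong (λ t → bit (t ∧ sel S d x y z)) (covers-suc-zero d (toℕ x) (toℕ y) (toℕ z) i j)

coverCount-◂-suc : ∀ {n} (L : Layer) (S : Selection 3 3 n) i j l →
  coverCount (L ◂ S) i j (suc l) ≡ layerCount L i j (suc l) + coverCount S i j l
coverCount-◂-suc L S i j l = trans (coverCount≡coverSum (L ◂ S) i j (suc l)) (trans (coverSum-◂ L S i j (suc l))
  (cong (λ s → layerCount L i j (suc l) + s) (trans shifted≡coverSum (sym (coverCount≡coverSum S i j l)))))
  where
  shifted≡coverSum : shiftedSum S i j (suc l) ≡ coverSum S i j l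
  shifted≡coverSum = sum-cong-≗ λ d → sum-cong-≗ λ x → sum-cong-≗ λ y → sum-cong-≗ λ z →
    cong (λ t → bit (t ∧ sel S d x y z)) (covers-suc-suc d (toℕ x) (toℕ y) (toℕ z) i j l)

-- The bricks starting in the first slab: along the first axis they must start at x = 0 (rows, indexed by y),
-- along the second at y = 0 (columns, indexed by x), along the third anywhere (pillars). The twelve other
-- positions of a Layer overhang the cross-section.
Overhang : Set
Overhang = Vec Bool 12

Slab : Set
Slab = Vec Bool 3 × Vec Bool 3 × Vec (Vec Bool 3) 3

layerOf : Overhang × Slab → Layer
layerOf (b₀ ∷ b₁ ∷ b₂ ∷ b₃ ∷ b₄ ∷ b₅ ∷ b₆ ∷ b₇ ∷ b₈ ∷ b₉ ∷ b₁₀ ∷ b₁₁ ∷ [] , r , c , v) =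
    (r ∷ (b₀ ∷ b₁ ∷ b₂ ∷ []) ∷ (b₃ ∷ b₄ ∷ b₅ ∷ []) ∷ [])
  ∷ ((lookup c 0F ∷ b₆ ∷ b₇ ∷ []) ∷ (lookup c 1F ∷ b₈ ∷ b₉ ∷ []) ∷ (lookup c 2F ∷ b₁₀ ∷ b₁₁ ∷ []) ∷ [])
  ∷ v
  ∷ []

layerParts : Layer → Overhang × Slab
layerParts ((r ∷ (b₀ ∷ b₁ ∷ b₂ ∷ []) ∷ (b₃ ∷ b₄ ∷ b₅ ∷ []) ∷ [])
          ∷ ((c₀ ∷ b₆ ∷ b₇ ∷ []) ∷ (c₁ ∷ b₈ ∷ b₉ ∷ []) ∷ (c₂ ∷ b₁₀ ∷ b₁₁ ∷ []) ∷ [])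
          ∷ v
          ∷ []) =
  b₀ ∷ b₁ ∷ b₂ ∷ b₃ ∷ b₄ ∷ b₅ ∷ b₆ ∷ b₇ ∷ b₈ ∷ b₉ ∷ b₁₀ ∷ b₁₁ ∷ [] , r , (c₀ ∷ c₁ ∷ c₂ ∷ []) , v

Layer↔Overhang×Slab : Layer ↔ (Overhang × Slab)
Layer↔Overhang×Slab = mk↔ₛ′ layerParts layerOf
  (λ { (_ ∷ _ ∷ _ ∷ _ ∷ _ ∷ _ ∷ _ ∷ _ ∷ _ ∷ _ ∷ _ ∷ _ ∷ [] , _ , (_ ∷ _ ∷ _ ∷ []) , _) → refl })
  (λ { ((_ ∷ (_ ∷ _ ∷ _ ∷ []) ∷ (_ ∷ _ ∷ _ ∷ []) ∷ [])
       ∷ ((_ ∷ _ ∷ _ ∷ []) ∷ (_ ∷ _ ∷ _ ∷ []) ∷ (_ ∷ _ ∷ _ ∷ []) ∷ []) ∷ _ ∷ []) → refl })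

slabLayer : Slab → Layer
slabLayer R = layerOf (replicate 12 false , R)

pillar : Vec (Vec Bool 3) 3 → Fin 3 → Fin 3 → Bool
pillar v i j = lookup (lookup v i) j

-- layerCount at a concrete cell normalises to these shapes: the sums over Fin 3 leave trailing + 0s.
trailing-zeros³ : ∀ a b c → a + 0 + 0 + (b + 0 + 0 + (c + 0 + 0 + 0)) ≡ a + (b + c)
trailing-zeros³ = solve-∀

layerCount-slab-zero : ∀ r c v (i j : Fin 3) →
  layerCount (slabLayer (r , c , v)) (toℕ i) (toℕ j) 0 ≡ bit (lookup r j) + (bit (lookup c i) + bit (pillar v i j))
layerCount-slab-zero (r₀ ∷ r₁ ∷ r₂ ∷ []) (c₀ ∷ c₁ ∷ c₂ ∷ [])
  ((v₀₀ ∷ v₀₁ ∷ v₀₂ ∷ []) ∷ (v₁₀ ∷ v₁₁ ∷ v₁₂ ∷ []) ∷ (v₂₀ ∷ v₂₁ ∷ v₂₂ ∷ []) ∷ []) = λ where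
  0F 0F → trailing-zeros³ (bit r₀) (bit c₀) (bit v₀₀)
  0F 1F → trailing-zeros³ (bit r₁) (bit c₀) (bit v₀₁)
  0F 2F → trailing-zeros³ (bit r₂) (bit c₀) (bit v₀₂)
  1F 0F → trailing-zeros³ (bit r₀) (bit c₁) (bit v₁₀)
  1F 1F → trailing-zeros³ (bit r₁) (bit c₁) (bit v₁₁)
  1F 2F → trailing-zeros³ (bit r₂) (bit c₁) (bit v₁₂)
  2F 0F → trailing-zeros³ (bit r₀) (bit c₂) (bit v₂₀)
  2F 1F → trailing-zeros³ (bit r₁) (bit c₂) (bit v₂₁)
  2F 2F → trailing-zeros³ (bit r₂) (bit c₂) (bit v₂₂)

trailing-zeros¹ : ∀ a → a + 0 + 0 + 0 ≡ a
trailing-zeros¹ = solve-∀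

layerCount-slab-suc : ∀ R (i j : Fin 3) l →
  layerCount (slabLayer R) (toℕ i) (toℕ j) (suc l) ≡ bit ((l <ᵇ 2) ∧ pillar (proj₂ (proj₂ R)) i j)
layerCount-slab-suc (_ , _ , (v₀ ∷ v₁ ∷ v₂ ∷ [])) = λ where
  0F 0F l → trailing-zeros¹ _
  0F 1F l → trailing-zeros¹ _
  0F 2F l → trailing-zeros¹ _
  1F 0F l → trailing-zeros¹ _
  1F 1F l → trailing-zeros¹ _
  1F 2F l → trailing-zeros¹ _
  2F 0F l → trailing-zeros¹ _
  2F 1F l → trailing-zeros¹ _
  2F 2F l → trailing-zeros¹ _

toℕ+1≤3 : ∀ (x : Fin 3) → T (toℕ x + 1 ≤ᵇ 3)
toℕ+1≤3 0F = tt
toℕ+1≤3 1F = tt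
toℕ+1≤3 2F = tt

slab-bricks-fit : ∀ n R → (∀ x y → T (pillar (proj₂ (proj₂ R)) x y) → 2 ≤ n) →
  ∀ d x y → T (layerBit (slabLayer R) d x y) → T (fits 3 3 (suc n) d (toℕ x) (toℕ y) 0)
slab-bricks-fit n (r , c , v) deep = λ where
  0F 0F y  _ → toℕ+1≤3 y ∧ᵀ tt
  0F 1F y  t → ⊥-elim (subst T (lookup-replicate y false) t)
  0F 2F y  t → ⊥-elim (subst T (lookup-replicate y false) t)
  1F x  0F _ → toℕ+1≤3 x ∧ᵀ tt
  1F 0F 1F ()
  1F 1F 1F ()
  1F 2F 1F ()
  1F 0F 2F ()
  1F 1F 2F ()
  1F 2F 2F ()
  2F x  y  t → toℕ+1≤3 x ∧ᵀ toℕ+1≤3 y ∧ᵀ <⇒<ᵇ (deep x y t)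

¬T⇒T-not : ∀ {b} → (T b → T false) → T (not b)
¬T⇒T-not {false} _ = tt
¬T⇒T-not {true}  f = f tt

-- Each of the twelve overhanging bricks would stick out of the box: there fits reduces to false.
overhang-absent : ∀ {n} b R →
  (∀ d x y → T (layerBit (layerOf (b , R)) d x y) → T (fits 3 3 (suc n) d (toℕ x) (toℕ y) 0)) → T (noneOf b)
overhang-absent (_ ∷ _ ∷ _ ∷ _ ∷ _ ∷ _ ∷ _ ∷ _ ∷ _ ∷ _ ∷ _ ∷ _ ∷ []) R fit =
     ¬T⇒T-not (fit 0F 1F 0F) ∧ᵀ ¬T⇒T-not (fit 0F 1F 1F) ∧ᵀ ¬T⇒T-not (fit 0F 1F 2F)
  ∧ᵀ ¬T⇒T-not (fit 0F 2F 0F) ∧ᵀ ¬T⇒T-not (fit 0F 2F 1F) ∧ᵀ ¬T⇒T-not (fit 0F 2F 2F)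
  ∧ᵀ ¬T⇒T-not (fit 1F 0F 1F) ∧ᵀ ¬T⇒T-not (fit 1F 0F 2F) ∧ᵀ ¬T⇒T-not (fit 1F 1F 1F)
  ∧ᵀ ¬T⇒T-not (fit 1F 1F 2F) ∧ᵀ ¬T⇒T-not (fit 1F 2F 1F) ∧ᵀ ¬T⇒T-not (fit 1F 2F 2F) ∧ᵀ tt

-- fillsCell s a b c: a cell of the first slab is covered exactly once, by its row a, its column b, its new
-- pillar c, or an earlier pillar (s > 0).
fillsCell : ℕ → Bool → Bool → Bool → Bool
fillsCell s a b c = bit a + (bit b + bit c) + bit (0 <ᵇ s) ≡ᵇ 1

-- A new pillar fills the next two slabs.
nextDepth : ℕ → Bool → ℕ
nextDepth s c = if c then 2 else pred s

fillsCell-pillar : ∀ s a b → T (fillsCell s a b true) → s ≡ 0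
fillsCell-pillar zero    false false _ = refl
fillsCell-pillar (suc s) false false ()
fillsCell-pillar zero    false true  ()
fillsCell-pillar (suc s) false true  ()
fillsCell-pillar zero    true  false ()
fillsCell-pillar (suc s) true  false ()
fillsCell-pillar zero    true  true  ()
fillsCell-pillar (suc s) true  true  ()

pending-step : ∀ s a b c l → T (fillsCell s a b c) →
  bit ((l <ᵇ 2) ∧ c) + bit (suc l <ᵇ s) ≡ bit (l <ᵇ nextDepth s c)
pending-step s a b true l t rewrite fillsCell-pillar s a b t with l <ᵇ 2
... | true  = refl
... | false = refl
pending-step s a b false l t rewrite ∧-zeroʳ (l <ᵇ 2) with s
... | zero  = refl
... | suc s = refl

nextDepth-≤ : ∀ n s c → (T c → 2 ≤ n) → s ≤ suc n → nextDepth s c ≤ n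
nextDepth-≤ n s       true  deep _         = deep tt
nextDepth-≤ n zero    false _    _         = z≤n
nextDepth-≤ n (suc s) false _    (s≤s s≤n) = s≤n

nextDepth-≤⇒deep : ∀ n s c → nextDepth s c ≤ n → T c → 2 ≤ n
nextDepth-≤⇒deep n s true 2≤n _ = 2≤n

nextDepth-≤⇒≤ : ∀ n s a b c → T (fillsCell s a b c) → nextDepth s c ≤ n → s ≤ suc n
nextDepth-≤⇒≤ n s       a b true  t _ rewrite fillsCell-pillar s a b t = z≤n
nextDepth-≤⇒≤ n zero    a b false t _   = z≤n
nextDepth-≤⇒≤ n (suc s) a b false t s≤n = s≤s s≤n

cellRules : Profile → Vec Bool 3 → Vec Bool 3 → Vec (Vec (Bool → Bool) 3) 3
cellRules σ r c = tabulate λ i → tabulate λ j → fillsCell (depth σ i j) (lookup r j) (lookup c i)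

fillsLayer : Profile → Slab → Bool
fillsLayer σ (r , c , v) = allOf (allOf (λ rule b → rule b)) (cellRules σ r c) v

advance : Profile → Slab → Profile
advance σ (r , c , v) = zipWith (zipWith nextDepth) σ v

fillsLayer⇔ : ∀ σ r c v →
  T (fillsLayer σ (r , c , v)) ⇔ (∀ i j → T (fillsCell (depth σ i j) (lookup r j) (lookup c i) (pillar v i j)))
fillsLayer⇔ σ r c v = mk⇔
  (λ t i j → subst (λ rule → T (rule (pillar v i j))) (rule≡ i j)
    (Equivalence.to (T-allOf⇔ _ (lookup (cellRules σ r c) i) (lookup v i))
      (Equivalence.to (T-allOf⇔ _ (cellRules σ r c) v) t i) j))
  (λ h → Equivalence.from (T-allOf⇔ _ (cellRules σ r c) v) λ i →
    Equivalence.from (T-allOf⇔ _ (lookup (cellRules σ r c) i) (lookup v i)) λ j →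
      subst (λ rule → T (rule (pillar v i j))) (sym (rule≡ i j)) (h i j))
  where
  rule : Fin 3 → Fin 3 → Bool → Bool
  rule i j = fillsCell (depth σ i j) (lookup r j) (lookup c i)
  rule≡ : ∀ i j → lookup (lookup (cellRules σ r c) i) j ≡ rule i j
  rule≡ i j = trans (cong (λ row → lookup row j) (lookup∘tabulate (λ i → tabulate (rule i)) i)) (lookup∘tabulate (rule i) j)

depth-advance : ∀ σ r c v i j → depth (advance σ (r , c , v)) i j ≡ nextDepth (depth σ i j) (pillar v i j)
depth-advance σ r c v i j =
  trans (cong (λ row → lookup row j) (lookup-zipWith (zipWith nextDepth) i σ v))
    (lookup-zipWith nextDepth j (lookup σ i) (lookup v i))

fillsCell⇔ : ∀ s a b c → T (fillsCell s a b c) ⇔ (bit a + (bit b + bit c) + bit (0 <ᵇ s) ≡ 1)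
fillsCell⇔ s a b c = mk⇔ (≡ᵇ⇒≡ _ 1) (≡⇒≡ᵇ _ 1)

coveredOnce-◂-zero : ∀ {n} σ r c v (S : Selection 3 3 n) i j →
  coverCount (slabLayer (r , c , v) ◂ S) (toℕ i) (toℕ j) 0 + pending σ i j 0
    ≡ bit (lookup r j) + (bit (lookup c i) + bit (pillar v i j)) + bit (0 <ᵇ depth σ i j)
coveredOnce-◂-zero σ r c v S i j = cong (_+ pending σ i j 0)
  (trans (coverCount-◂-zero (slabLayer (r , c , v)) S (toℕ i) (toℕ j)) (layerCount-slab-zero r c v i j))

coveredOnce-◂-suc : ∀ {n} σ r c v (S : Selection 3 3 n) i j l →
  T (fillsCell (depth σ i j) (lookup r j) (lookup c i) (pillar v i j)) →
  coverCount (slabLayer (r , c , v) ◂ S) (toℕ i) (toℕ j) (suc l) + pending σ i j (suc l)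
    ≡ coverCount S (toℕ i) (toℕ j) l + pending (advance σ (r , c , v)) i j l
coveredOnce-◂-suc σ r c v S i j l fills = begin
  coverCount (L ◂ S) (toℕ i) (toℕ j) (suc l) + pending σ i j (suc l)
    ≡⟨ cong (_+ pending σ i j (suc l)) (coverCount-◂-suc L S (toℕ i) (toℕ j) l) ⟩
  layerCount L (toℕ i) (toℕ j) (suc l) + k + pending σ i j (suc l)
    ≡⟨ cong (λ x → x + k + pending σ i j (suc l)) (layerCount-slab-suc (r , c , v) i j l) ⟩
  bit ((l <ᵇ 2) ∧ pillar v i j) + k + pending σ i j (suc l)
    ≡⟨ trans (cong (_+ pending σ i j (suc l)) (+-comm _ k)) (+-assoc k _ _) ⟩
  k + (bit ((l <ᵇ 2) ∧ pillar v i j) + pending σ i j (suc l))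
    ≡⟨ cong (λ s → k + s) (pending-step (depth σ i j) (lookup r j) (lookup c i) (pillar v i j) l fills) ⟩
  k + bit (l <ᵇ nextDepth (depth σ i j) (pillar v i j))
    ≡⟨ cong (λ s → k + bit (l <ᵇ s)) (sym (depth-advance σ r c v i j)) ⟩
  k + pending (advance σ (r , c , v)) i j l ∎
  where
  open ≡-Reasoning
  L = slabLayer (r , c , v)
  k = coverCount S (toℕ i) (toℕ j) l

pillar-fits⇒deep : ∀ n (x y : Fin 3) → T (fits 3 3 (suc n) 2F (toℕ x) (toℕ y) 0) → 2 ≤ n
pillar-fits⇒deep n x y t =
  <ᵇ⇒< 1 n (proj₂ (Equivalence.to (T-∧ {toℕ y + 1 ≤ᵇ 3}) (proj₂ (Equivalence.to (T-∧ {toℕ x + 1 ≤ᵇ 3}) t))))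

IsPartialTiling-◂⁻ : ∀ {n} σ r c v (S : Selection 3 3 n) → IsPartialTiling σ (slabLayer (r , c , v) ◂ S) →
  T (fillsLayer σ (r , c , v)) × IsPartialTiling (advance σ (r , c , v)) S
IsPartialTiling-◂⁻ {n} σ r c v S P = Equivalence.from (fillsLayer⇔ σ r c v) fills , record
  { bricks-fit   = λ d x y z t → subst T (fits-suc n d (toℕ x) (toℕ y) (toℕ z))
                     (bricks-fit d x y (suc z) (subst T (sym (sel-◂-suc L S d x y z)) t))
  ; covered-once = λ i j l → trans (sym (coveredOnce-◂-suc σ r c v S i j (toℕ l) (fills i j))) (covered-once i j (suc l))
  ; depth≤       = λ i j → subst (_≤ n) (sym (depth-advance σ r c v i j))
                     (nextDepth-≤ n (depth σ i j) (pillar v i j) (deep i j) (depth≤ i j))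
  }
  where
  open IsPartialTiling P
  L = slabLayer (r , c , v)
  fills : ∀ i j → T (fillsCell (depth σ i j) (lookup r j) (lookup c i) (pillar v i j))
  fills i j = Equivalence.from (fillsCell⇔ (depth σ i j) (lookup r j) (lookup c i) (pillar v i j))
    (trans (sym (coveredOnce-◂-zero σ r c v S i j)) (covered-once i j 0F))
  deep : ∀ x y → T (pillar v x y) → 2 ≤ n
  deep x y t = pillar-fits⇒deep n x y (bricks-fit 2F x y 0F (subst T (sym (sel-◂-zero L S 2F x y)) t))

IsPartialTiling-◂⁺ : ∀ {n} σ r c v (S : Selection 3 3 n) → T (fillsLayer σ (r , c , v)) →
  IsPartialTiling (advance σ (r , c , v)) S → IsPartialTiling σ (slabLayer (r , c , v) ◂ S)
IsPartialTiling-◂⁺ {n} σ r c v S t P = record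
  { bricks-fit   = λ where
      d x y 0F       u → slab-bricks-fit n (r , c , v) deep d x y (subst T (sel-◂-zero L S d x y) u)
      d x y (suc z) u → subst T (sym (fits-suc n d (toℕ x) (toℕ y) (toℕ z)))
                           (bricks-fit d x y z (subst T (sel-◂-suc L S d x y z) u))
  ; covered-once = λ where
      i j 0F       → trans (coveredOnce-◂-zero σ r c v S i j)
                       (Equivalence.to (fillsCell⇔ (depth σ i j) (lookup r j) (lookup c i) (pillar v i j)) (fills i j))
      i j (suc l) → trans (coveredOnce-◂-suc σ r c v S i j (toℕ l) (fills i j)) (covered-once i j l)
  ; depth≤       = λ i j → nextDepth-≤⇒≤ n (depth σ i j) (lookup r j) (lookup c i) (pillar v i j) (fills i j)
                     (subst (_≤ n) (depth-advance σ r c v i j) (depth≤ i j))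
  }
  where
  open IsPartialTiling P
  L = slabLayer (r , c , v)
  fills : ∀ i j → T (fillsCell (depth σ i j) (lookup r j) (lookup c i) (pillar v i j))
  fills = Equivalence.to (fillsLayer⇔ σ r c v) t
  deep : ∀ x y → T (pillar v x y) → 2 ≤ n
  deep x y = nextDepth-≤⇒deep n (depth σ x y) (pillar v x y) (subst (_≤ n) (depth-advance σ r c v x y) (depth≤ x y))

overhang-absent-◂ : ∀ {n} σ b R (S : Selection 3 3 n) → IsPartialTiling σ (layerOf (b , R) ◂ S) → T (noneOf b)
overhang-absent-◂ σ b R S P = overhang-absent b R λ d x y u →
  IsPartialTiling.bricks-fit P d x y 0F (subst T (sym (sel-◂-zero (layerOf (b , R)) S d x y)) u)

isPartialTiling-◂⁻ : ∀ {n} σ b R (S : Selection 3 3 n) → T (isPartialTiling σ (layerOf (b , R) ◂ S)) →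
  T (noneOf b ∧ fillsLayer σ R) × T (isPartialTiling (advance σ R) S)
isPartialTiling-◂⁻ σ b (r , c , v) S t
  with P ← Equivalence.to (isPartialTiling⇔ σ _) t
  with refl ← noneOf⇒replicate b (overhang-absent-◂ σ b (r , c , v) S P)
  = let (fills , P′) = IsPartialTiling-◂⁻ σ r c v S P in fills , Equivalence.from (isPartialTiling⇔ _ S) P′

isPartialTiling-◂⁺ : ∀ {n} σ b R (S : Selection 3 3 n) → T (noneOf b ∧ fillsLayer σ R) →
  T (isPartialTiling (advance σ R) S) → T (isPartialTiling σ (layerOf (b , R) ◂ S))
isPartialTiling-◂⁺ σ b (r , c , v) S u t
  with refl ← noneOf⇒replicate b (proj₁ (Equivalence.to (T-∧ {noneOf b}) u))
  = Equivalence.from (isPartialTiling⇔ σ _) (IsPartialTiling-◂⁺ σ r c v S u (Equivalence.to (isPartialTiling⇔ _ S) t))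

peel : ∀ {n} σ (b : Overhang) (R : Slab) →
  Σ (Selection 3 3 n) (λ S → T (isPartialTiling σ (layerOf (b , R) ◂ S)))
    ↔ (T (noneOf b ∧ fillsLayer σ R) × PartialTiling (advance σ R) n)
peel σ b R = Σ-T-split _ (noneOf b ∧ fillsLayer σ R) (isPartialTiling (advance σ R)) λ S →
  mk⇔ (isPartialTiling-◂⁻ σ b R S) (λ (u , t) → isPartialTiling-◂⁺ σ b R S u t)

vectors₃ : List (Vec Bool 3)
vectors₃ = choices (λ _ → bools) (replicate 3 tt)

pillarChoices : Profile → Vec Bool 3 → Vec Bool 3 → List (Vec (Vec Bool 3) 3)
pillarChoices σ r c = choices (choices (λ rule → filterᵇ rule bools)) (cellRules σ r c)

layerFillings : Profile → List Slab
layerFillings σ =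
  concatMap (λ r → map (r ,_) (concatMap (λ c → map (c ,_) (pillarChoices σ r c)) vectors₃)) vectors₃

enumerates-layerFillings : ∀ σ → Enumerates (fillsLayer σ) (layerFillings σ)
enumerates-layerFillings σ =
  enumerates-× (enumerates-Vec enumerates-bools 3) λ r →
  enumerates-× (enumerates-Vec enumerates-bools 3) λ c →
  enumerates-choices _ _ (enumerates-choices _ _ (λ rule → enumerates-filterᵇ rule enumerates-bools)) (cellRules σ r c)

count : Profile → ℕ → ℕ
count σ zero    = bit (allDepthsFit 0 σ)
count σ (suc n) = sum (map (λ R → count (advance σ R) n) (layerFillings σ))

PartialTiling-0↔ : ∀ σ → PartialTiling σ 0 ↔ Fin (count σ 0)
PartialTiling-0↔ σ = singleton (allDepthsFit 0 σ)
  where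
  empty : Selection 3 3 0
  empty = replicate 3 (replicate 3 (replicate 3 []))
  unique : ∀ (S : Selection 3 3 0) → empty ≡ S
  unique = Vec-allEqual (Vec-allEqual (Vec-allEqual λ { [] [] → refl })) empty
  singleton : ∀ b → Σ (Selection 3 3 0) (λ _ → T b) ↔ Fin (bit b)
  singleton true  = mk↔ₛ′ (λ _ → 0F) (λ _ → empty , tt)
    (λ { 0F → refl ; (suc ()) }) (λ (S , _) → cong (_, tt) (unique S))
  singleton false = mk↔ₛ′ (λ { (_ , ()) }) (λ ()) (λ ()) (λ { (_ , ()) })

PartialTiling↔Fin : ∀ n σ → PartialTiling σ n ↔ Fin (count σ n)
PartialTiling↔Fin zero    σ = PartialTiling-0↔ σ
PartialTiling↔Fin (suc n) σ = begin
  PartialTiling σ (suc n)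
    ↔⟨ Σ-T-↔ split {isPartialTiling σ} {λ ((b , R) , S) → isPartialTiling σ (layerOf (b , R) ◂ S)}
         (λ S t → subst (T ∘ isPartialTiling σ) (sym (Inverse.strictlyInverseʳ split S)) t) (λ _ t → t) ⟩
  Σ ((Overhang × Slab) × Selection 3 3 n) (λ ((b , R) , S) → T (isPartialTiling σ (layerOf (b , R) ◂ S)))
    ↔⟨ Σ-assoc ⟩
  Σ (Overhang × Slab) (λ (b , R) → Σ (Selection 3 3 n) (λ S → T (isPartialTiling σ (layerOf (b , R) ◂ S))))
    ↔⟨ Σ-↔ ↔-refl (λ {(b , R)} → peel σ b R) ⟩
  Σ (Overhang × Slab) (λ (b , R) → T (noneOf b ∧ fillsLayer σ R) × PartialTiling (advance σ R) n)
    ↔⟨ Σ-assoc ⟩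
  Σ Overhang (λ b → Σ Slab (λ R → T (noneOf b ∧ fillsLayer σ R) × PartialTiling (advance σ R) n))
    ↔⟨ Σ-↔ ↔-refl (λ {b} → ↔-trans (Σ-↔ ↔-refl (λ {R} → T-∧-× (noneOf b) (fillsLayer σ R)))
                                  (Σ-T-× (noneOf b))) ⟩
  Σ Overhang (λ b → T (noneOf b) × Σ Slab (λ R → T (fillsLayer σ R) × PartialTiling (advance σ R) n))
    ↔⟨ Σ-noneOf 12 ⟩
  Σ Slab (λ R → T (fillsLayer σ R) × PartialTiling (advance σ R) n)
    ↔⟨ enumerates-layerFillings σ _ ⟩
  Coproduct (layerFillings σ) (λ R → PartialTiling (advance σ R) n)
    ↔⟨ Coproduct-cong (layerFillings σ) (λ R → PartialTiling↔Fin n (advance σ R)) ⟩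
  Coproduct (layerFillings σ) (λ R → Fin (count (advance σ R) n))
    ↔⟨ Coproduct-Fin (λ R → count (advance σ R) n) (layerFillings σ) ⟩
  Fin (count σ (suc n)) ∎
  where
  open EquationalReasoning
  split : Selection 3 3 (suc n) ↔ ((Overhang × Slab) × Selection 3 3 n)
  split = ↔-trans Selection-suc↔ (Layer↔Overhang×Slab ×-↔ ↔-refl)

tilings↔count : ∀ n → Tiling 3 3 n ↔ Fin (count flat n)
tilings↔count n = ↔-trans (Tiling↔PartialTiling-flat n) (PartialTiling↔Fin n flat)

-- The transfer matrix

-- The 51 profiles reachable from flat (which is state 0F) and, for each, the states reached through the layers
-- of layerFillings in that order; found by computer search, checked by advance-state.
states : Vec Profile 51
states =
    ((0 ∷ 0 ∷ 0 ∷ []) ∷ (0 ∷ 0 ∷ 0 ∷ []) ∷ (0 ∷ 0 ∷ 0 ∷ []) ∷ [])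
  ∷ ((2 ∷ 2 ∷ 2 ∷ []) ∷ (2 ∷ 2 ∷ 2 ∷ []) ∷ (2 ∷ 2 ∷ 2 ∷ []) ∷ [])
  ∷ ((2 ∷ 2 ∷ 2 ∷ []) ∷ (2 ∷ 2 ∷ 2 ∷ []) ∷ (0 ∷ 0 ∷ 0 ∷ []) ∷ [])
  ∷ ((2 ∷ 2 ∷ 2 ∷ []) ∷ (0 ∷ 0 ∷ 0 ∷ []) ∷ (2 ∷ 2 ∷ 2 ∷ []) ∷ [])
  ∷ ((2 ∷ 2 ∷ 2 ∷ []) ∷ (0 ∷ 0 ∷ 0 ∷ []) ∷ (0 ∷ 0 ∷ 0 ∷ []) ∷ [])
  ∷ ((0 ∷ 0 ∷ 0 ∷ []) ∷ (2 ∷ 2 ∷ 2 ∷ []) ∷ (2 ∷ 2 ∷ 2 ∷ []) ∷ [])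
  ∷ ((0 ∷ 0 ∷ 0 ∷ []) ∷ (2 ∷ 2 ∷ 2 ∷ []) ∷ (0 ∷ 0 ∷ 0 ∷ []) ∷ [])
  ∷ ((0 ∷ 0 ∷ 0 ∷ []) ∷ (0 ∷ 0 ∷ 0 ∷ []) ∷ (2 ∷ 2 ∷ 2 ∷ []) ∷ [])
  ∷ ((2 ∷ 2 ∷ 0 ∷ []) ∷ (2 ∷ 2 ∷ 0 ∷ []) ∷ (2 ∷ 2 ∷ 0 ∷ []) ∷ [])
  ∷ ((2 ∷ 0 ∷ 2 ∷ []) ∷ (2 ∷ 0 ∷ 2 ∷ []) ∷ (2 ∷ 0 ∷ 2 ∷ []) ∷ [])
  ∷ ((2 ∷ 0 ∷ 0 ∷ []) ∷ (2 ∷ 0 ∷ 0 ∷ []) ∷ (2 ∷ 0 ∷ 0 ∷ []) ∷ [])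
  ∷ ((0 ∷ 2 ∷ 2 ∷ []) ∷ (0 ∷ 2 ∷ 2 ∷ []) ∷ (0 ∷ 2 ∷ 2 ∷ []) ∷ [])
  ∷ ((0 ∷ 2 ∷ 0 ∷ []) ∷ (0 ∷ 2 ∷ 0 ∷ []) ∷ (0 ∷ 2 ∷ 0 ∷ []) ∷ [])
  ∷ ((0 ∷ 0 ∷ 2 ∷ []) ∷ (0 ∷ 0 ∷ 2 ∷ []) ∷ (0 ∷ 0 ∷ 2 ∷ []) ∷ [])
  ∷ ((1 ∷ 1 ∷ 1 ∷ []) ∷ (1 ∷ 1 ∷ 1 ∷ []) ∷ (1 ∷ 1 ∷ 1 ∷ []) ∷ [])
  ∷ ((1 ∷ 1 ∷ 1 ∷ []) ∷ (1 ∷ 1 ∷ 1 ∷ []) ∷ (2 ∷ 2 ∷ 2 ∷ []) ∷ [])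
  ∷ ((1 ∷ 1 ∷ 1 ∷ []) ∷ (1 ∷ 1 ∷ 1 ∷ []) ∷ (0 ∷ 0 ∷ 0 ∷ []) ∷ [])
  ∷ ((1 ∷ 1 ∷ 1 ∷ []) ∷ (2 ∷ 2 ∷ 2 ∷ []) ∷ (1 ∷ 1 ∷ 1 ∷ []) ∷ [])
  ∷ ((1 ∷ 1 ∷ 1 ∷ []) ∷ (0 ∷ 0 ∷ 0 ∷ []) ∷ (1 ∷ 1 ∷ 1 ∷ []) ∷ [])
  ∷ ((1 ∷ 1 ∷ 1 ∷ []) ∷ (2 ∷ 2 ∷ 2 ∷ []) ∷ (2 ∷ 2 ∷ 2 ∷ []) ∷ [])
  ∷ ((1 ∷ 1 ∷ 1 ∷ []) ∷ (2 ∷ 2 ∷ 2 ∷ []) ∷ (0 ∷ 0 ∷ 0 ∷ []) ∷ [])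
  ∷ ((1 ∷ 1 ∷ 1 ∷ []) ∷ (0 ∷ 0 ∷ 0 ∷ []) ∷ (2 ∷ 2 ∷ 2 ∷ []) ∷ [])
  ∷ ((1 ∷ 1 ∷ 1 ∷ []) ∷ (0 ∷ 0 ∷ 0 ∷ []) ∷ (0 ∷ 0 ∷ 0 ∷ []) ∷ [])
  ∷ ((2 ∷ 2 ∷ 2 ∷ []) ∷ (1 ∷ 1 ∷ 1 ∷ []) ∷ (1 ∷ 1 ∷ 1 ∷ []) ∷ [])
  ∷ ((0 ∷ 0 ∷ 0 ∷ []) ∷ (1 ∷ 1 ∷ 1 ∷ []) ∷ (1 ∷ 1 ∷ 1 ∷ []) ∷ [])
  ∷ ((2 ∷ 2 ∷ 2 ∷ []) ∷ (1 ∷ 1 ∷ 1 ∷ []) ∷ (2 ∷ 2 ∷ 2 ∷ []) ∷ [])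
  ∷ ((2 ∷ 2 ∷ 2 ∷ []) ∷ (1 ∷ 1 ∷ 1 ∷ []) ∷ (0 ∷ 0 ∷ 0 ∷ []) ∷ [])
  ∷ ((0 ∷ 0 ∷ 0 ∷ []) ∷ (1 ∷ 1 ∷ 1 ∷ []) ∷ (2 ∷ 2 ∷ 2 ∷ []) ∷ [])
  ∷ ((0 ∷ 0 ∷ 0 ∷ []) ∷ (1 ∷ 1 ∷ 1 ∷ []) ∷ (0 ∷ 0 ∷ 0 ∷ []) ∷ [])
  ∷ ((2 ∷ 2 ∷ 2 ∷ []) ∷ (2 ∷ 2 ∷ 2 ∷ []) ∷ (1 ∷ 1 ∷ 1 ∷ []) ∷ [])
  ∷ ((2 ∷ 2 ∷ 2 ∷ []) ∷ (0 ∷ 0 ∷ 0 ∷ []) ∷ (1 ∷ 1 ∷ 1 ∷ []) ∷ [])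
  ∷ ((0 ∷ 0 ∷ 0 ∷ []) ∷ (2 ∷ 2 ∷ 2 ∷ []) ∷ (1 ∷ 1 ∷ 1 ∷ []) ∷ [])
  ∷ ((0 ∷ 0 ∷ 0 ∷ []) ∷ (0 ∷ 0 ∷ 0 ∷ []) ∷ (1 ∷ 1 ∷ 1 ∷ []) ∷ [])
  ∷ ((1 ∷ 1 ∷ 2 ∷ []) ∷ (1 ∷ 1 ∷ 2 ∷ []) ∷ (1 ∷ 1 ∷ 2 ∷ []) ∷ [])
  ∷ ((1 ∷ 1 ∷ 0 ∷ []) ∷ (1 ∷ 1 ∷ 0 ∷ []) ∷ (1 ∷ 1 ∷ 0 ∷ []) ∷ [])
  ∷ ((1 ∷ 2 ∷ 1 ∷ []) ∷ (1 ∷ 2 ∷ 1 ∷ []) ∷ (1 ∷ 2 ∷ 1 ∷ []) ∷ [])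
  ∷ ((1 ∷ 0 ∷ 1 ∷ []) ∷ (1 ∷ 0 ∷ 1 ∷ []) ∷ (1 ∷ 0 ∷ 1 ∷ []) ∷ [])
  ∷ ((1 ∷ 2 ∷ 2 ∷ []) ∷ (1 ∷ 2 ∷ 2 ∷ []) ∷ (1 ∷ 2 ∷ 2 ∷ []) ∷ [])
  ∷ ((1 ∷ 2 ∷ 0 ∷ []) ∷ (1 ∷ 2 ∷ 0 ∷ []) ∷ (1 ∷ 2 ∷ 0 ∷ []) ∷ [])
  ∷ ((1 ∷ 0 ∷ 2 ∷ []) ∷ (1 ∷ 0 ∷ 2 ∷ []) ∷ (1 ∷ 0 ∷ 2 ∷ []) ∷ [])
  ∷ ((1 ∷ 0 ∷ 0 ∷ []) ∷ (1 ∷ 0 ∷ 0 ∷ []) ∷ (1 ∷ 0 ∷ 0 ∷ []) ∷ [])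
  ∷ ((2 ∷ 1 ∷ 1 ∷ []) ∷ (2 ∷ 1 ∷ 1 ∷ []) ∷ (2 ∷ 1 ∷ 1 ∷ []) ∷ [])
  ∷ ((0 ∷ 1 ∷ 1 ∷ []) ∷ (0 ∷ 1 ∷ 1 ∷ []) ∷ (0 ∷ 1 ∷ 1 ∷ []) ∷ [])
  ∷ ((2 ∷ 1 ∷ 2 ∷ []) ∷ (2 ∷ 1 ∷ 2 ∷ []) ∷ (2 ∷ 1 ∷ 2 ∷ []) ∷ [])
  ∷ ((2 ∷ 1 ∷ 0 ∷ []) ∷ (2 ∷ 1 ∷ 0 ∷ []) ∷ (2 ∷ 1 ∷ 0 ∷ []) ∷ [])
  ∷ ((0 ∷ 1 ∷ 2 ∷ []) ∷ (0 ∷ 1 ∷ 2 ∷ []) ∷ (0 ∷ 1 ∷ 2 ∷ []) ∷ [])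
  ∷ ((0 ∷ 1 ∷ 0 ∷ []) ∷ (0 ∷ 1 ∷ 0 ∷ []) ∷ (0 ∷ 1 ∷ 0 ∷ []) ∷ [])
  ∷ ((2 ∷ 2 ∷ 1 ∷ []) ∷ (2 ∷ 2 ∷ 1 ∷ []) ∷ (2 ∷ 2 ∷ 1 ∷ []) ∷ [])
  ∷ ((2 ∷ 0 ∷ 1 ∷ []) ∷ (2 ∷ 0 ∷ 1 ∷ []) ∷ (2 ∷ 0 ∷ 1 ∷ []) ∷ [])
  ∷ ((0 ∷ 2 ∷ 1 ∷ []) ∷ (0 ∷ 2 ∷ 1 ∷ []) ∷ (0 ∷ 2 ∷ 1 ∷ []) ∷ [])
  ∷ ((0 ∷ 0 ∷ 1 ∷ []) ∷ (0 ∷ 0 ∷ 1 ∷ []) ∷ (0 ∷ 0 ∷ 1 ∷ []) ∷ [])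
  ∷ []

state : Fin 51 → Profile
state = lookup states

successors : Vec (List (Fin 51)) 51
successors =
    (# 1 ∷ # 2 ∷ # 3 ∷ # 4 ∷ # 5 ∷ # 6 ∷ # 7 ∷ # 0 ∷ # 8 ∷ # 9 ∷ # 10 ∷ # 11 ∷ # 12 ∷ # 13 ∷ # 0 ∷ [])
  ∷ (# 14 ∷ [])
  ∷ (# 15 ∷ # 16 ∷ [])
  ∷ (# 17 ∷ # 18 ∷ [])
  ∷ (# 19 ∷ # 20 ∷ # 21 ∷ # 22 ∷ [])
  ∷ (# 23 ∷ # 24 ∷ [])
  ∷ (# 25 ∷ # 26 ∷ # 27 ∷ # 28 ∷ [])
  ∷ (# 29 ∷ # 30 ∷ # 31 ∷ # 32 ∷ [])
  ∷ (# 33 ∷ # 34 ∷ [])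
  ∷ (# 35 ∷ # 36 ∷ [])
  ∷ (# 37 ∷ # 38 ∷ # 39 ∷ # 40 ∷ [])
  ∷ (# 41 ∷ # 42 ∷ [])
  ∷ (# 43 ∷ # 44 ∷ # 45 ∷ # 46 ∷ [])
  ∷ (# 47 ∷ # 48 ∷ # 49 ∷ # 50 ∷ [])
  ∷ (# 0 ∷ [])
  ∷ (# 32 ∷ [])
  ∷ (# 7 ∷ # 0 ∷ [])
  ∷ (# 28 ∷ [])
  ∷ (# 6 ∷ # 0 ∷ [])
  ∷ (# 24 ∷ [])
  ∷ (# 27 ∷ # 28 ∷ [])
  ∷ (# 31 ∷ # 32 ∷ [])
  ∷ (# 5 ∷ # 6 ∷ # 7 ∷ # 0 ∷ [])
  ∷ (# 22 ∷ [])
  ∷ (# 4 ∷ # 0 ∷ [])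
  ∷ (# 18 ∷ [])
  ∷ (# 21 ∷ # 22 ∷ [])
  ∷ (# 30 ∷ # 32 ∷ [])
  ∷ (# 3 ∷ # 4 ∷ # 7 ∷ # 0 ∷ [])
  ∷ (# 16 ∷ [])
  ∷ (# 20 ∷ # 22 ∷ [])
  ∷ (# 26 ∷ # 28 ∷ [])
  ∷ (# 2 ∷ # 4 ∷ # 6 ∷ # 0 ∷ [])
  ∷ (# 50 ∷ [])
  ∷ (# 13 ∷ # 0 ∷ [])
  ∷ (# 46 ∷ [])
  ∷ (# 12 ∷ # 0 ∷ [])
  ∷ (# 42 ∷ [])
  ∷ (# 45 ∷ # 46 ∷ [])
  ∷ (# 49 ∷ # 50 ∷ [])
  ∷ (# 11 ∷ # 12 ∷ # 13 ∷ # 0 ∷ [])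
  ∷ (# 40 ∷ [])
  ∷ (# 10 ∷ # 0 ∷ [])
  ∷ (# 36 ∷ [])
  ∷ (# 39 ∷ # 40 ∷ [])
  ∷ (# 48 ∷ # 50 ∷ [])
  ∷ (# 9 ∷ # 10 ∷ # 13 ∷ # 0 ∷ [])
  ∷ (# 34 ∷ [])
  ∷ (# 38 ∷ # 40 ∷ [])
  ∷ (# 44 ∷ # 46 ∷ [])
  ∷ (# 8 ∷ # 10 ∷ # 12 ∷ # 0 ∷ [])
  ∷ []

advance-state : ∀ s → map (advance (state s)) (layerFillings (state s)) ≡ map state (lookup successors s)
advance-state = tabulate-≡⇒≗ {f = λ s → map (advance (state s)) (layerFillings (state s))} refl

count-state-suc : ∀ n s → count (state s) (suc n) ≡ sum (map (λ t → count (state t) n) (lookup successors s))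
count-state-suc n s = begin
  sum (map (λ R → count (advance (state s) R) n) (layerFillings (state s)))
    ≡⟨ cong sum (map-∘ (layerFillings (state s))) ⟩
  sum (map (λ σ → count σ n) (map (advance (state s)) (layerFillings (state s))))
    ≡⟨ cong (sum ∘ map (λ σ → count σ n)) (advance-state s) ⟩
  sum (map (λ σ → count σ n) (map state (lookup successors s)))
    ≡⟨ cong sum (map-∘ (lookup successors s)) ⟨
  sum (map (λ t → count (state t) n) (lookup successors s)) ∎
  where open ≡-Reasoning

step : Vec ℕ 51 → Vec ℕ 51
step w = tabulate λ s → sum (map (lookup w) (lookup successors s))

initial : Vec ℕ 51
initial = tabulate λ s → count (state s) 0

zeros : Vec ℕ 51
zeros = replicate 51 0

countVector : ℕ → Vec ℕ 51
countVector zero    = initial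
countVector (suc n) = step (countVector n)

lookup-countVector : ∀ n s → lookup (countVector n) s ≡ count (state s) n
lookup-countVector zero    s = lookup∘tabulate (λ s → count (state s) 0) s
lookup-countVector (suc n) s = begin
  lookup (step (countVector n)) s
    ≡⟨ lookup∘tabulate (λ s → sum (map (lookup (countVector n)) (lookup successors s))) s ⟩
  sum (map (lookup (countVector n)) (lookup successors s))
    ≡⟨ cong sum (map-cong (lookup-countVector n) (lookup successors s)) ⟩
  sum (map (λ t → count (state t) n) (lookup successors s))
    ≡⟨ count-state-suc n s ⟨
  count (state s) (suc n) ∎
  where open ≡-Reasoning

seriesVector : ℕ → Vec ℕ 51
seriesVector zero                = initial
seriesVector (suc zero)          = zeros
seriesVector (suc (suc zero))    = zeros
seriesVector (suc (suc (suc k))) = step (seriesVector k)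

seriesVector-3* : ∀ n → seriesVector (3 * n) ≡ countVector n
seriesVector-3* zero    = refl
seriesVector-3* (suc n) rewrite *-suc 3 n = cong step (seriesVector-3* n)

seriesVector-∤ : ∀ k → ¬ (3 ∣ k) → seriesVector k ≡ zeros
seriesVector-∤ zero                3∤0 = ⊥-elim (3∤0 (divides 0 refl))
seriesVector-∤ (suc zero)          _   = refl
seriesVector-∤ (suc (suc zero))    _   = refl
seriesVector-∤ (suc (suc (suc k))) 3∤k = cong step (seriesVector-∤ k (3∤k ∘ ∣m∣n⇒∣m+n ∣-refl))

-- count (state s) n for n ≤ 12, so that the finite checks below need not unfold the recursion.
countTable : List (Vec ℕ 51)
countTable =
    (1 ∷ 0 ∷ 0 ∷ 0 ∷ 0 ∷ 0 ∷ 0 ∷ 0 ∷ 0 ∷ 0 ∷ 0 ∷ 0 ∷ 0 ∷ 0 ∷ 0 ∷ 0 ∷ 0 ∷ 0 ∷ 0 ∷ 0 ∷ 0 ∷ 0 ∷ 0 ∷ 0 ∷ 0 ∷ 0 ∷ 0 ∷ 0 ∷ 0 ∷ 0 ∷ 0 ∷ 0 ∷ 0 ∷ 0 ∷ 0 ∷ 0 ∷ 0 ∷ 0 ∷ 0 ∷ 0 ∷ 0 ∷ 0 ∷ 0 ∷ 0 ∷ 0 ∷ 0 ∷ 0 ∷ 0 ∷ 0 ∷ 0 ∷ 0 ∷ [])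
  ∷ (2 ∷ 0 ∷ 0 ∷ 0 ∷ 0 ∷ 0 ∷ 0 ∷ 0 ∷ 0 ∷ 0 ∷ 0 ∷ 0 ∷ 0 ∷ 0 ∷ 1 ∷ 0 ∷ 1 ∷ 0 ∷ 1 ∷ 0 ∷ 0 ∷ 0 ∷ 1 ∷ 0 ∷ 1 ∷ 0 ∷ 0 ∷ 0 ∷ 1 ∷ 0 ∷ 0 ∷ 0 ∷ 1 ∷ 0 ∷ 1 ∷ 0 ∷ 1 ∷ 0 ∷ 0 ∷ 0 ∷ 1 ∷ 0 ∷ 1 ∷ 0 ∷ 0 ∷ 0 ∷ 1 ∷ 0 ∷ 0 ∷ 0 ∷ 1 ∷ [])
  ∷ (4 ∷ 1 ∷ 1 ∷ 1 ∷ 1 ∷ 1 ∷ 1 ∷ 1 ∷ 1 ∷ 1 ∷ 1 ∷ 1 ∷ 1 ∷ 1 ∷ 2 ∷ 1 ∷ 2 ∷ 1 ∷ 2 ∷ 1 ∷ 1 ∷ 1 ∷ 2 ∷ 1 ∷ 2 ∷ 1 ∷ 1 ∷ 1 ∷ 2 ∷ 1 ∷ 1 ∷ 1 ∷ 2 ∷ 1 ∷ 2 ∷ 1 ∷ 2 ∷ 1 ∷ 1 ∷ 1 ∷ 2 ∷ 1 ∷ 2 ∷ 1 ∷ 1 ∷ 1 ∷ 2 ∷ 1 ∷ 1 ∷ 1 ∷ 2 ∷ [])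
  ∷ (21 ∷ 2 ∷ 3 ∷ 3 ∷ 5 ∷ 3 ∷ 5 ∷ 5 ∷ 3 ∷ 3 ∷ 5 ∷ 3 ∷ 5 ∷ 5 ∷ 4 ∷ 2 ∷ 5 ∷ 2 ∷ 5 ∷ 2 ∷ 3 ∷ 3 ∷ 7 ∷ 2 ∷ 5 ∷ 2 ∷ 3 ∷ 3 ∷ 7 ∷ 2 ∷ 3 ∷ 3 ∷ 7 ∷ 2 ∷ 5 ∷ 2 ∷ 5 ∷ 2 ∷ 3 ∷ 3 ∷ 7 ∷ 2 ∷ 5 ∷ 2 ∷ 3 ∷ 3 ∷ 7 ∷ 2 ∷ 3 ∷ 3 ∷ 7 ∷ [])
  ∷ (92 ∷ 4 ∷ 7 ∷ 7 ∷ 15 ∷ 7 ∷ 15 ∷ 15 ∷ 7 ∷ 7 ∷ 15 ∷ 7 ∷ 15 ∷ 15 ∷ 21 ∷ 7 ∷ 26 ∷ 7 ∷ 26 ∷ 5 ∷ 10 ∷ 10 ∷ 34 ∷ 7 ∷ 26 ∷ 5 ∷ 10 ∷ 10 ∷ 34 ∷ 5 ∷ 10 ∷ 10 ∷ 34 ∷ 7 ∷ 26 ∷ 7 ∷ 26 ∷ 5 ∷ 10 ∷ 10 ∷ 34 ∷ 7 ∷ 26 ∷ 5 ∷ 10 ∷ 10 ∷ 34 ∷ 5 ∷ 10 ∷ 10 ∷ 34 ∷ [])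
  ∷ (320 ∷ 21 ∷ 33 ∷ 33 ∷ 59 ∷ 33 ∷ 59 ∷ 59 ∷ 33 ∷ 33 ∷ 59 ∷ 33 ∷ 59 ∷ 59 ∷ 92 ∷ 34 ∷ 107 ∷ 34 ∷ 107 ∷ 26 ∷ 44 ∷ 44 ∷ 129 ∷ 34 ∷ 107 ∷ 26 ∷ 44 ∷ 44 ∷ 129 ∷ 26 ∷ 44 ∷ 44 ∷ 129 ∷ 34 ∷ 107 ∷ 34 ∷ 107 ∷ 26 ∷ 44 ∷ 44 ∷ 129 ∷ 34 ∷ 107 ∷ 26 ∷ 44 ∷ 44 ∷ 129 ∷ 26 ∷ 44 ∷ 44 ∷ 129 ∷ [])
  ∷ (1213 ∷ 92 ∷ 141 ∷ 141 ∷ 243 ∷ 141 ∷ 243 ∷ 243 ∷ 141 ∷ 141 ∷ 243 ∷ 141 ∷ 243 ∷ 243 ∷ 320 ∷ 129 ∷ 379 ∷ 129 ∷ 379 ∷ 107 ∷ 173 ∷ 173 ∷ 471 ∷ 129 ∷ 379 ∷ 107 ∷ 173 ∷ 173 ∷ 471 ∷ 107 ∷ 173 ∷ 173 ∷ 471 ∷ 129 ∷ 379 ∷ 129 ∷ 379 ∷ 107 ∷ 173 ∷ 173 ∷ 471 ∷ 129 ∷ 379 ∷ 107 ∷ 173 ∷ 173 ∷ 471 ∷ 107 ∷ 173 ∷ 173 ∷ 471 ∷ [])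
  ∷ (4822 ∷ 320 ∷ 508 ∷ 508 ∷ 924 ∷ 508 ∷ 924 ∷ 924 ∷ 508 ∷ 508 ∷ 924 ∷ 508 ∷ 924 ∷ 924 ∷ 1213 ∷ 471 ∷ 1456 ∷ 471 ∷ 1456 ∷ 379 ∷ 644 ∷ 644 ∷ 1840 ∷ 471 ∷ 1456 ∷ 379 ∷ 644 ∷ 644 ∷ 1840 ∷ 379 ∷ 644 ∷ 644 ∷ 1840 ∷ 471 ∷ 1456 ∷ 471 ∷ 1456 ∷ 379 ∷ 644 ∷ 644 ∷ 1840 ∷ 471 ∷ 1456 ∷ 379 ∷ 644 ∷ 644 ∷ 1840 ∷ 379 ∷ 644 ∷ 644 ∷ 1840 ∷ [])
  ∷ (18556 ∷ 1213 ∷ 1927 ∷ 1927 ∷ 3507 ∷ 1927 ∷ 3507 ∷ 3507 ∷ 1927 ∷ 1927 ∷ 3507 ∷ 1927 ∷ 3507 ∷ 3507 ∷ 4822 ∷ 1840 ∷ 5746 ∷ 1840 ∷ 5746 ∷ 1456 ∷ 2484 ∷ 2484 ∷ 7178 ∷ 1840 ∷ 5746 ∷ 1456 ∷ 2484 ∷ 2484 ∷ 7178 ∷ 1456 ∷ 2484 ∷ 2484 ∷ 7178 ∷ 1840 ∷ 5746 ∷ 1840 ∷ 5746 ∷ 1456 ∷ 2484 ∷ 2484 ∷ 7178 ∷ 1840 ∷ 5746 ∷ 1456 ∷ 2484 ∷ 2484 ∷ 7178 ∷ 1456 ∷ 2484 ∷ 2484 ∷ 7178 ∷ [])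
  ∷ (70929 ∷ 4822 ∷ 7586 ∷ 7586 ∷ 13602 ∷ 7586 ∷ 13602 ∷ 13602 ∷ 7586 ∷ 7586 ∷ 13602 ∷ 7586 ∷ 13602 ∷ 13602 ∷ 18556 ∷ 7178 ∷ 22063 ∷ 7178 ∷ 22063 ∷ 5746 ∷ 9662 ∷ 9662 ∷ 27497 ∷ 7178 ∷ 22063 ∷ 5746 ∷ 9662 ∷ 9662 ∷ 27497 ∷ 5746 ∷ 9662 ∷ 9662 ∷ 27497 ∷ 7178 ∷ 22063 ∷ 7178 ∷ 22063 ∷ 5746 ∷ 9662 ∷ 9662 ∷ 27497 ∷ 7178 ∷ 22063 ∷ 5746 ∷ 9662 ∷ 9662 ∷ 27497 ∷ 5746 ∷ 9662 ∷ 9662 ∷ 27497 ∷ [])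
  ∷ (273808 ∷ 18556 ∷ 29241 ∷ 29241 ∷ 52567 ∷ 29241 ∷ 52567 ∷ 52567 ∷ 29241 ∷ 29241 ∷ 52567 ∷ 29241 ∷ 52567 ∷ 52567 ∷ 70929 ∷ 27497 ∷ 84531 ∷ 27497 ∷ 84531 ∷ 22063 ∷ 37159 ∷ 37159 ∷ 105719 ∷ 27497 ∷ 84531 ∷ 22063 ∷ 37159 ∷ 37159 ∷ 105719 ∷ 22063 ∷ 37159 ∷ 37159 ∷ 105719 ∷ 27497 ∷ 84531 ∷ 27497 ∷ 84531 ∷ 22063 ∷ 37159 ∷ 37159 ∷ 105719 ∷ 27497 ∷ 84531 ∷ 22063 ∷ 37159 ∷ 37159 ∷ 105719 ∷ 22063 ∷ 37159 ∷ 37159 ∷ 105719 ∷ [])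
  ∷ (1057020 ∷ 70929 ∷ 112028 ∷ 112028 ∷ 202100 ∷ 112028 ∷ 202100 ∷ 202100 ∷ 112028 ∷ 112028 ∷ 202100 ∷ 112028 ∷ 202100 ∷ 202100 ∷ 273808 ∷ 105719 ∷ 326375 ∷ 105719 ∷ 326375 ∷ 84531 ∷ 142878 ∷ 142878 ∷ 408183 ∷ 105719 ∷ 326375 ∷ 84531 ∷ 142878 ∷ 142878 ∷ 408183 ∷ 84531 ∷ 142878 ∷ 142878 ∷ 408183 ∷ 105719 ∷ 326375 ∷ 105719 ∷ 326375 ∷ 84531 ∷ 142878 ∷ 142878 ∷ 408183 ∷ 105719 ∷ 326375 ∷ 84531 ∷ 142878 ∷ 142878 ∷ 408183 ∷ 84531 ∷ 142878 ∷ 142878 ∷ 408183 ∷ [])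
  ∷ (4069737 ∷ 273808 ∷ 432094 ∷ 432094 ∷ 778470 ∷ 432094 ∷ 778470 ∷ 778470 ∷ 432094 ∷ 432094 ∷ 778470 ∷ 432094 ∷ 778470 ∷ 778470 ∷ 1057020 ∷ 408183 ∷ 1259120 ∷ 408183 ∷ 1259120 ∷ 326375 ∷ 551061 ∷ 551061 ∷ 1573248 ∷ 408183 ∷ 1259120 ∷ 326375 ∷ 551061 ∷ 551061 ∷ 1573248 ∷ 326375 ∷ 551061 ∷ 551061 ∷ 1573248 ∷ 408183 ∷ 1259120 ∷ 408183 ∷ 1259120 ∷ 326375 ∷ 551061 ∷ 551061 ∷ 1573248 ∷ 408183 ∷ 1259120 ∷ 326375 ∷ 551061 ∷ 551061 ∷ 1573248 ∷ 326375 ∷ 551061 ∷ 551061 ∷ 1573248 ∷ [])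
  ∷ []

spaced : List (Vec ℕ 51) → ℕ → Vec ℕ 51
spaced []       _                   = zeros
spaced (w ∷ ws) zero                = w
spaced (w ∷ ws) (suc zero)          = zeros
spaced (w ∷ ws) (suc (suc zero))    = zeros
spaced (w ∷ ws) (suc (suc (suc k))) = spaced ws k

tableSeries : ℕ → Vec ℕ 51
tableSeries = spaced countTable

table-step : ∀ k → k < 35 → step (tableSeries k) ≡ tableSeries (3 + k)
table-step k k<35 = subst (λ m → step (tableSeries m) ≡ tableSeries (3 + m)) (toℕ-fromℕ< k<35)
  (tabulate-≡⇒≗ {f = λ i → step (tableSeries (toℕ i))} {g = λ i → tableSeries (3 + toℕ i)} refl (fromℕ< k<35))

seriesVector≡tableSeries : ∀ k → k ≤ 37 → seriesVector k ≡ tableSeries k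
seriesVector≡tableSeries zero                _                       = refl
seriesVector≡tableSeries (suc zero)          _                       = refl
seriesVector≡tableSeries (suc (suc zero))    _                       = refl
seriesVector≡tableSeries (suc (suc (suc k))) (s≤s (s≤s (s≤s k≤34))) =
  trans (cong step (seriesVector≡tableSeries k (m≤n⇒m≤o+n 3 k≤34))) (table-step k (s≤s k≤34))

-- The generating function

timesDenominator : (ℕ → ℤ) → ℕ → ℤ
timesDenominator f = mulPS (spread3 den1W) (mulPS (spread3 den2W) f)

timesDenominator-cong≤ : ∀ {f g : ℕ → ℤ} N → (∀ k → k ≤ N → f k ≡ g k) →
  timesDenominator f N ≡ timesDenominator g N
timesDenominator-cong≤ N f≗g =
  mulPS-cong≤ (spread3 den1W) N (λ k k≤N → mulPS-cong≤ (spread3 den2W) k (λ j j≤k → f≗g j (≤-trans j≤k k≤N)))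

timesDenominator-cong : ∀ {f g : ℕ → ℤ} → (∀ k → f k ≡ g k) → ∀ N → timesDenominator f N ≡ timesDenominator g N
timesDenominator-cong f≗g N = timesDenominator-cong≤ N (λ k _ → f≗g k)

timesDenominator-sumℤ : ∀ {A : Set} (F : A → ℕ → ℤ) ts N →
  timesDenominator (λ k → sumℤ (map (λ t → F t k) ts)) N ≡ sumℤ (map (λ t → timesDenominator (F t) N) ts)
timesDenominator-sumℤ F ts N =
  trans (mulPS-cong (spread3 den1W) (mulPS-sumℤ (spread3 den2W) F ts) N)
    (mulPS-sumℤ (spread3 den1W) (λ t → mulPS (spread3 den2W) (F t)) ts N)

-- The correction terms of mulPS-suc reduce to + 0: the two factors of the denominator have degrees 3 and 27.
timesDenominator-shift : ∀ (f : ℕ → ℤ) M → timesDenominator f (35 + M) ≡ timesDenominator (f ∘ suc) (34 + M)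
timesDenominator-shift f M = begin
  mulPS D₁ (mulPS D₂ f) (35 + M)
    ≡⟨ mulPS-suc D₁ (mulPS D₂ f) (34 + M) ⟩
  mulPS D₁ (mulPS D₂ f ∘ suc) (34 + M) +ℤ + 0
    ≡⟨ ℤ.+-identityʳ _ ⟩
  mulPS D₁ (mulPS D₂ f ∘ suc) (34 + M)
    ≡⟨ mulPS-cong D₁ (mulPS-suc D₂ f) (34 + M) ⟩
  mulPS D₁ (λ k → mulPS D₂ (f ∘ suc) k +ℤ coeff D₂ (suc k) *ℤ f 0) (34 + M)
    ≡⟨ mulPS-+ D₁ (mulPS D₂ (f ∘ suc)) (λ k → coeff D₂ (suc k) *ℤ f 0) (34 + M) ⟩
  timesDenominator (f ∘ suc) (34 + M) +ℤ + 0
    ≡⟨ ℤ.+-identityʳ _ ⟩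
  timesDenominator (f ∘ suc) (34 + M) ∎
  where
  open ≡-Reasoning
  D₁ = spread3 den1W
  D₂ = spread3 den2W

coefficients : Fin 51 → ℕ → ℤ
coefficients s k = + lookup (seriesVector k) s

coefficients-step : ∀ s k → coefficients s (3 + k) ≡ sumℤ (map (λ t → coefficients t k) (lookup successors s))
coefficients-step s k = begin
  + lookup (step (seriesVector k)) s
    ≡⟨ cong +_ (lookup∘tabulate (λ s → sum (map (lookup (seriesVector k)) (lookup successors s))) s) ⟩
  + sum (map (lookup (seriesVector k)) (lookup successors s))
    ≡⟨ pos-sum (map (lookup (seriesVector k)) (lookup successors s)) ⟩
  sumℤ (map +_ (map (lookup (seriesVector k)) (lookup successors s)))
    ≡⟨ cong sumℤ (map-∘ (lookup successors s)) ⟨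
  sumℤ (map (λ t → coefficients t k) (lookup successors s)) ∎
  where open ≡-Reasoning

timesDenominator-table : ∀ s N → N ≤ 37 →
  timesDenominator (coefficients s) N ≡ timesDenominator (λ k → + lookup (tableSeries k) s) N
timesDenominator-table s N N≤37 =
  timesDenominator-cong≤ N (λ k k≤N → cong (λ w → + lookup w s) (seriesVector≡tableSeries k (≤-trans k≤N N≤37)))

annihilation-table : tabulate (λ (i : Fin 3) → tabulate λ s → timesDenominator (λ k → + lookup (tableSeries k) s) (35 + toℕ i))
                   ≡ tabulate (λ _ → tabulate λ _ → + 0)
annihilation-table = refl

annihilated-35-37 : ∀ (i : Fin 3) s → timesDenominator (coefficients s) (35 + toℕ i) ≡ + 0
annihilated-35-37 i s = trans (timesDenominator-table s (35 + toℕ i) (+-monoʳ-≤ 35 (toℕ≤pred[n] i)))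
  (tabulate-≡⇒≗ {f = λ s → timesDenominator (λ k → + lookup (tableSeries k) s) (35 + toℕ i)} {g = λ _ → + 0}
    (tabulate-≡⇒≗ {f = λ i → tabulate λ s → timesDenominator (λ k → + lookup (tableSeries k) s) (35 + toℕ i)}
                  {g = λ _ → tabulate λ _ → + 0} annihilation-table i) s)

annihilated-35+ : ∀ M s → timesDenominator (coefficients s) (35 + M) ≡ + 0
annihilated-35+ 0                   s = annihilated-35-37 0F s
annihilated-35+ 1                   s = annihilated-35-37 1F s
annihilated-35+ 2                   s = annihilated-35-37 2F s
annihilated-35+ (suc (suc (suc M))) s = begin
  timesDenominator (coefficients s) (35 + (3 + M))
    ≡⟨ timesDenominator-shift (coefficients s) (3 + M) ⟩
  timesDenominator (coefficients s ∘ suc) (35 + (2 + M))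
    ≡⟨ timesDenominator-shift (coefficients s ∘ suc) (2 + M) ⟩
  timesDenominator (λ k → coefficients s (2 + k)) (35 + (1 + M))
    ≡⟨ timesDenominator-shift (λ k → coefficients s (2 + k)) (1 + M) ⟩
  timesDenominator (λ k → coefficients s (3 + k)) (35 + M)
    ≡⟨ timesDenominator-cong (coefficients-step s) (35 + M) ⟩
  timesDenominator (λ k → sumℤ (map (λ t → coefficients t k) (lookup successors s))) (35 + M)
    ≡⟨ timesDenominator-sumℤ coefficients (lookup successors s) (35 + M) ⟩
  sumℤ (map (λ t → timesDenominator (coefficients t) (35 + M)) (lookup successors s))
    ≡⟨ sumℤ-zero _ (lookup successors s) (annihilated-35+ M) ⟩
  + 0 ∎
  where open ≡-Reasoning

numerator-table : tabulate (λ (N : Fin 35) → timesDenominator (λ k → + lookup (tableSeries k) 0F) (toℕ N))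
                ≡ tabulate (λ N → coeff (spread3 numW) (toℕ N))
numerator-table = refl

generatingFunction : ∀ N → timesDenominator (coefficients 0F) N ≡ coeff (spread3 numW) N
generatingFunction N with N <? 35
... | yes N<35 = trans (timesDenominator-table 0F N (≤-trans (<⇒≤ N<35) (≤ᵇ⇒≤ 35 37 _)))
  (subst (λ m → timesDenominator (λ k → + lookup (tableSeries k) 0F) m ≡ coeff (spread3 numW) m) (toℕ-fromℕ< N<35)
    (tabulate-≡⇒≗ {f = λ N → timesDenominator (λ k → + lookup (tableSeries k) 0F) (toℕ N)}
                  {g = λ N → coeff (spread3 numW) (toℕ N)} numerator-table (fromℕ< N<35)))
... | no N≮35 = subst (λ m → timesDenominator (coefficients 0F) m ≡ coeff (spread3 numW) m) (m+[n∸m]≡n (≮⇒≥ N≮35))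
  (annihilated-35+ (N ∸ 35) 0F)

series-coefficient : (a : ℕ → ℕ) → a 0 ≡ 1 → (∀ N → ¬ (3 ∣ N) → a N ≡ 0) →
  (∀ n → 1 ≤ n → Tiling 3 3 n ↔ Fin (a (3 * n))) → ∀ k → a k ≡ lookup (seriesVector k) 0F
series-coefficient a a₀ a∤ a-tilings k with 3 ∣? k
... | no 3∤k = trans (a∤ k 3∤k) (cong (λ w → lookup w 0F) (sym (seriesVector-∤ k 3∤k)))
... | yes (divides q refl) = subst (λ k → a k ≡ lookup (seriesVector k) 0F) (*-comm 3 q) (multiple q)
  where
  multiple : ∀ n → a (3 * n) ≡ lookup (seriesVector (3 * n)) 0F
  multiple zero    = a₀
  multiple (suc n) = begin
    a (3 * suc n)                        ≡⟨ ↔⇒≡ (↔-trans (↔-sym (a-tilings (suc n) (s≤s z≤n)))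
                                                          (tilings↔count (suc n))) ⟩
    count flat (suc n)                   ≡⟨ lookup-countVector (suc n) 0F ⟨
    lookup (countVector (suc n)) 0F      ≡⟨ cong (λ w → lookup w 0F) (seriesVector-3* (suc n)) ⟨
    lookup (seriesVector (3 * suc n)) 0F ∎
    where open ≡-Reasoning

mainTheorem13 : (a : ℕ → ℕ)
    → a 0 ≡ 1
    → (∀ N → ¬ (3 ∣ N) → a N ≡ 0)
    → (∀ n → 1 ≤ n → Tiling 3 3 n ↔ Fin (a (3 * n)))
    → (∀ N → mulPS (spread3 den1W) (mulPS (spread3 den2W) (λ k → + a k)) N
               ≡ coeff (spread3 numW) N)
      × a 3 ≡ 2 × a 6 ≡ 4 × a 9 ≡ 21 × a 12 ≡ 92 × a 15 ≡ 320
mainTheorem13 a a₀ a∤ a-tilings =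
  generating , value 3 _ refl , value 6 _ refl , value 9 _ refl , value 12 _ refl , value 15 _ refl
  where
  a≡series : ∀ k → a k ≡ lookup (seriesVector k) 0F
  a≡series = series-coefficient a a₀ a∤ a-tilings
  generating : ∀ N → timesDenominator (λ k → + a k) N ≡ coeff (spread3 numW) N
  generating N = trans (timesDenominator-cong (λ k → cong +_ (a≡series k)) N) (generatingFunction N)
  value : ∀ k {v} → T (k ≤ᵇ 37) → lookup (tableSeries k) 0F ≡ v → a k ≡ v
  value k k≤37 row =
    trans (a≡series k) (trans (cong (λ w → lookup w 0F) (seriesVector≡tableSeries k (≤ᵇ⇒≤ k 37 k≤37))) row)
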